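{- Let $R$ be a commutative ring in which $2$ is not a zero-divisor and which contains compatible primitive $2^k$-th roots of unity $\omega_{[k]}$ ($\omega_{[k+1]}^2=\omega_{[k]}$) for all sufficiently large $k$. Let $A,B\in R[x]$ with $\deg A<m$, $\deg B<n$, given in read-only input arrays, and let $X_0,\dots,X_{r-1}$ with $r=n+m-1$ be a read/write output array. Then the algorithm PRODUCT described in the context terminates with $X_s=C_s$ for all $0\le s<r$, where $C=AB=\sum_s C_sx^s$. It runs in time $O((m+n)\log(m+n))$ and uses $O(1)$ auxiliary space (apart from the input and output arrays, it stores only $O(1)$ ring elements and pointers).
   Context: Notation: for $s\ge0$ let $\omega_s=\omega_{[k]}^{\mathrm{rev}_k s}$ where $k\ge\lceil\lg(s+1)\rceil$ and $\mathrm{rev}_k s$ is the length-$k$ bit reversal of $s$. For a polynomial $F$, $\hat F_s=F(\omega_s)$. Memory model: cells hold ring elements or pointers (integers bounded in absolute value by a constant multiple of the input size); input arrays may be read but not written; the output array may be read and written; auxiliary space counts all other cells. FFT denotes an in-place transform on a subarray of power-of-two length $L$ which, given coefficients $F_0,\dots,F_{L-1}$ of $F$, overwrites them with $\hat F_0,\dots,\hat F_{L-1}$ in $O(L\log L)$ time and $O(1)$ auxiliary space; ITFT denotes an in-place transform on an array of length $r$ which, given $\hat F_0,\dots,\hat F_{r-1}$ for $\deg F<r$, overwrites them with $F_0,\dots,F_{r-1}$ in $O(r\log r)$ time and $O(1)$ auxiliary space. Algorithm PRODUCT: set $r=n+m-1$, $q=0$. While $q<r-1$: let $\ell=\lfloor\lg(r-q)\rfloor-1$,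 $L=2^\ell$; set $X_q,\dots,X_{q+2L-1}$ to $0$; for $0\le i<m$ add $\omega_q^{\,i}A_i$ to $X_{q+(i\bmod L)}$; apply FFT to $[X_q,\dots,X_{q+L-1}]$; for $0\le i<n$ add $\omega_q^{\,i}B_i$ to $X_{q+L+(i\bmod L)}$; apply FFT to $[X_{q+L},\dots,X_{q+2L-1}]$; for $0\le i<L$ set $X_{q+i}\leftarrow X_{q+i}X_{q+L+i}$; set $q\leftarrow q+L$. After the loop, set $X_{r-1}\leftarrow A(\omega_{r-1})B(\omega_{r-1})$ and apply ITFT to $[X_0,\dots,X_{r-1}]$. -}

module Defs where

open import Level using (Level)
open import Algebra.Bundles using (CommutativeRing; Semiring)
import Algebra.Definitions.RawSemiring as RS
open import Data.Nat using (ℕ; zero; suc; _+_; _*_; _∸_; _^_; _≤_; _<_; _⊔_; _<ᵇ_; _≡ᵇ_; _%_; _/_)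
open import Data.Nat.Properties using (m^n≢0)
open import Data.Nat.Logarithm using (⌊log₂_⌋; ⌈log₂_⌉)
open import Data.Fin using (Fin; toℕ)
open import Data.Bool using (Bool; true; false; if_then_else_; _∧_)
open import Data.Product using (_×_)
open import Relation.Binary.PropositionalEquality using (_≡_)

-- length-k bit reversal:  rev k s = Σ_{t<k} bit_t(s) · 2^(k-1-t)
rev : ℕ → ℕ → ℕ
rev zero    s = 0
rev (suc k) s = (s % 2) * 2 ^ k + rev k (s / 2)

mod2^ : ℕ → ℕ → ℕ
mod2^ i ℓ = _%_ i (2 ^ ℓ) {{m^n≢0 2 ℓ}}

module _ {c ℓ′ : Level} (R : CommutativeRing c ℓ′) where
  open CommutativeRing R renaming (_+_ to _+ᴿ_; _*_ to _*ᴿ_)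
  open RS (Semiring.rawSemiring semiring) using (sum) renaming (_^_ to _^ᴿ_)

  -- w is a primitive 2^k-th root of unity (principal form:
  -- w^(2^k) = 1 and, for k ≥ 1, w^(2^(k-1)) = -1)
  PrimitiveRoot2^ : ℕ → Carrier → Set ℓ′
  PrimitiveRoot2^ k w =
    (w ^ᴿ (2 ^ k) ≈ 1#) × (∀ j → k ≡ suc j → w ^ᴿ (2 ^ j) ≈ - 1#)

  TwoNonZeroDivisor : Set (c Level.⊔ ℓ′)
  TwoNonZeroDivisor = ∀ x → x +ᴿ x ≈ 0# → x ≈ 0#

  -- ω_s = ω_[k]^(rev_k s), with k = max(K, ⌈lg(s+1) ⌉), where the roots
  -- ω_[k] are given (primitive and compatible) for all k ≥ K
  omegaIdx : (ℕ → Carrier) → ℕ → ℕ → Carrier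
  omegaIdx ω K s = ω k ^ᴿ rev k s
    where k = K ⊔ (⌈log₂ (suc s) ⌉)

  evalPoly : ℕ → (ℕ → Carrier) → Carrier → Carrier
  evalPoly len F x = sum {len} (λ i → F (toℕ i) *ᴿ x ^ᴿ toℕ i)

  ext : ∀ {m} → (Fin m → Carrier) → ℕ → Carrier
  ext {zero}  A i       = 0#
  ext {suc m} A zero    = A Fin.zero
  ext {suc m} A (suc i) = ext {m} (λ j → A (Fin.suc j)) i

  prodCoeff : ∀ {m n} → (Fin m → Carrier) → (Fin n → Carrier) → ℕ → Carrier
  prodCoeff A B s = sum {suc s} (λ i → ext A (toℕ i) *ᴿ ext B (s ∸ toℕ i))

  FFTSpec : (ℕ → Carrier) → ℕ → (ℕ → (ℕ → Carrier) → ℕ → Carrier) → Set (c Level.⊔ ℓ′)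
  FFTSpec ω K fft = ∀ l (F : ℕ → Carrier) t → t < 2 ^ l →
    fft (2 ^ l) F t ≈ evalPoly (2 ^ l) F (omegaIdx ω K t)

  ITFTSpec : (ℕ → Carrier) → ℕ → (ℕ → (ℕ → Carrier) → ℕ → Carrier) → Set (c Level.⊔ ℓ′)
  ITFTSpec ω K itft = ∀ r (F V : ℕ → Carrier) → 1 ≤ r →
    (∀ t → t < r → V t ≈ evalPoly r F (omegaIdx ω K t)) →
    ∀ t → t < r → itft r V t ≈ F t

  -- The state consists of the read/write output array X plus a FIXED
  -- finite set of registers (pointers q, l (L = 2^l), i; ring registers
  -- w, p, a, b) and a program counter: this is the O(1) auxiliary space.
  -- Inputs A, B are read-only (they are parameters, never part of the state).
  -- Any write to X at an index ≥ r sends the machine to the fault state.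

  data Phase : Set where
    loopHead zeroX loadW addA fft1 addB fft2 mulX
      finW hornA hornB finMul itftP done fault : Phase

  record State : Set c where
    constructor st
    field
      pc   : Phase
      q    : ℕ
      l    : ℕ
      i    : ℕ
      w p a b : Carrier
      X    : ℕ → Carrier

  upd : (ℕ → Carrier) → ℕ → Carrier → ℕ → Carrier
  upd X k v j = if j ≡ᵇ k then v else X j

  blit : (ℕ → Carrier) → ℕ → ℕ → (ℕ → Carrier) → ℕ → Carrier
  blit X off len Y j =
    if (off <ᵇ suc j) ∧ (j <ᵇ off + len) then Y (j ∸ off) else X j

  module Machine (ω : ℕ → Carrier) (K : ℕ)
                 (fft itft : ℕ → (ℕ → Carrier) → ℕ → Carrier)
                 {m n : ℕ} (A : Fin m → Carrier) (B : Fin n → Carrier) where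

    r : ℕ
    r = n + m ∸ 1

    A′ B′ : ℕ → Carrier
    A′ = ext A
    B′ = ext B

    init : (ℕ → Carrier) → State
    init X₀ = st loopHead 0 0 0 0# 0# 0# 0# X₀

    step : State → State
    step s@(st loopHead q l i w p a b X) =
      if suc q <ᵇ r
      then st zeroX q ((⌊log₂ (r ∸ q) ⌋) ∸ 1) 0 w p a b X
      else st finW q l i w p a b X
    step s@(st zeroX q l i w p a b X) =
      if i <ᵇ 2 ^ l + 2 ^ l
      then (if q + i <ᵇ r then st zeroX q l (suc i) w p a b (upd X (q + i) 0#)
                          else st fault q l i w p a b X)
      else st loadW q l i w p a b X
    step s@(st loadW q l i w p a b X) =
      st addA q l 0 (omegaIdx ω K q) 1# a b X
    step s@(st addA q l i w p a b X) =
      if i <ᵇ m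
      then (if k <ᵇ r then st addA q l (suc i) w (p *ᴿ w) a b (upd X k (X k +ᴿ p *ᴿ A′ i))
                      else st fault q l i w p a b X)
      else st fft1 q l i w p a b X
      where k = q + mod2^ i l
    step s@(st fft1 q l i w p a b X) =
      if q + 2 ^ l <ᵇ suc r
      then st addB q l 0 w 1# a b (blit X q (2 ^ l) (fft (2 ^ l) (λ t → X (q + t))))
      else st fault q l i w p a b X
    step s@(st addB q l i w p a b X) =
      if i <ᵇ n
      then (if k <ᵇ r then st addB q l (suc i) w (p *ᴿ w) a b (upd X k (X k +ᴿ p *ᴿ B′ i))
                      else st fault q l i w p a b X)
      else st fft2 q l i w p a b X
      where k = q + 2 ^ l + mod2^ i l
    step s@(st fft2 q l i w p a b X) =
      if q + 2 ^ l + 2 ^ l <ᵇ suc r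
      then st mulX q l 0 w p a b
             (blit X (q + 2 ^ l) (2 ^ l) (fft (2 ^ l) (λ t → X (q + 2 ^ l + t))))
      else st fault q l i w p a b X
    step s@(st mulX q l i w p a b X) =
      if i <ᵇ 2 ^ l
      then (if q + 2 ^ l + i <ᵇ r
            then st mulX q l (suc i) w p a b (upd X (q + i) (X (q + i) *ᴿ X (q + 2 ^ l + i)))
            else st fault q l i w p a b X)
      else st loopHead (q + 2 ^ l) l i w p a b X
    step s@(st finW q l i w p a b X) =
      st hornA q l m (omegaIdx ω K (r ∸ 1)) p 0# b X
    step s@(st hornA q l zero w p a b X) = st hornB q l n w p a 0# X
    step s@(st hornA q l (suc j) w p a b X) = st hornA q l j w p (a *ᴿ w +ᴿ A′ j) b X
    step s@(st hornB q l zero w p a b X) = st finMul q l 0 w p a b X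
    step s@(st hornB q l (suc j) w p a b X) = st hornB q l j w p a (b *ᴿ w +ᴿ B′ j) X
    step s@(st finMul q l i w p a b X) =
      if r ∸ 1 <ᵇ r then st itftP q l i w p a b (upd X (r ∸ 1) (a *ᴿ b))
                    else st fault q l i w p a b X
    step s@(st itftP q l i w p a b X) =
      st done q l i w p a b (blit X 0 r (itft r X))
    step s@(st done q l i w p a b X) = s
    step s@(st fault q l i w p a b X) = s

    -- cost (time) of the step taken from a state: 1 for elementary steps,
    -- L(lg L + 1) for an FFT of length L, r(lg r + 1) for the ITFT, and
    -- O(k) for computing ω_s = ω_[k]^(rev_k s) by repeated squaring
    cost : State → ℕ
    cost (st fft1  q l i w p a b X) = 2 ^ l * (l + 1)
    cost (st fft2  q l i w p a b X) = 2 ^ l * (l + 1)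
    cost (st itftP q l i w p a b X) = r * ((⌈log₂ r ⌉) + 1)
    cost (st loadW q l i w p a b X) = (K ⊔ (⌈log₂ (suc q) ⌉)) + 1
    cost (st finW  q l i w p a b X) = (K ⊔ (⌈log₂ r ⌉)) + 1
    cost (st done  q l i w p a b X) = 0
    cost (st fault q l i w p a b X) = 0
    cost _ = 1

    run : ℕ → (ℕ → Carrier) → State
    run zero    X₀ = init X₀
    run (suc t) X₀ = step (run t X₀)

    totalCost : ℕ → (ℕ → Carrier) → ℕ
    totalCost zero    X₀ = 0
    totalCost (suc t) X₀ = totalCost t X₀ + cost (run t X₀)

module Submission where

-- PRODUCT stores C(ω_s) = A(ω_s) B(ω_s) in X_s for s < r, block by block, and the ITFT then recovers C since
-- deg C < r. A block starts at q with length L = 2^ℓ, 2L ≤ r − q, and L ∣ q (every block length still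
-- admissible at q divides q). Folding A(ω_q x) modulo x^L − 1 and transforming yields its values at the ω_t,
-- t < L; as ω_t^L = 1 these are A(ω_q ω_t) = A(ω_(q+t)), because bit reversal adds without carry on q + t.
-- An iteration costs O(L lg L + m + n + K + lg r), and ⌊lg(r − q)⌋ drops at least every second iteration, so
-- the loop costs O((m + n) lg(m + n)); every pointer register stays ≤ m + n.

open import Defs
open import Level using (Level)
open import Algebra.Bundles using (CommutativeRing; Semiring)
open import Data.Bool using (true; false; T; if_then_else_)
open import Data.Bool.Properties using (T-∧)
open import Data.Empty using (⊥-elim)
open import Data.Fin using (Fin; toℕ)
open import Data.Nat
open import Data.Nat.Properties hiding (+-assoc; +-comm; +-identityˡ; +-identityʳ; *-assoc; *-comm; *-identityˡ; *-identityʳ)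
import Data.Nat.Properties as ℕ
open import Data.Nat.DivMod using (m≡m%n+[m/n]*n; m%n<n; m*n%n≡0; m*n/n≡m; [m+kn]%n≡m%n; +-distrib-/-∣ˡ; m<n*o⇒m/o<n)
open import Data.Nat.Divisibility using (_∣_; divides; _∣0; ∣m∣n⇒∣m+n)
open import Data.Nat.Induction using (<-rec)
open import Data.Nat.Logarithm
open import Data.Nat.Solver using (module +-*-Solver)
open import Data.Product using (∃; _×_; _,_; proj₁; proj₂)
open import Data.Sum using (_⊎_; inj₁; inj₂)
open import Function.Bundles using (Equivalence)
open import Relation.Binary.PropositionalEquality as ≡ using (_≡_; _≢_; refl)
open import Relation.Nullary using (¬_; Dec; yes; no)
import Relation.Binary.Reasoning.Setoid

n<2^n : ∀ n → n < 2 ^ n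
n<2^n zero    = s≤s z≤n
n<2^n (suc n) = begin-strict
  suc n          <⟨ s≤s (n<2^n n) ⟩
  suc (2 ^ n)    ≤⟨ +-monoˡ-≤ (2 ^ n) (m^n>0 2 n) ⟩
  2 ^ n + 2 ^ n  ≡⟨ ≡.cong (2 ^ n +_) (≡.sym (ℕ.+-identityʳ _)) ⟩
  2 ^ suc n      ∎
  where open ≤-Reasoning

2^m≤n⇒m≤⌊log₂n⌋ : ∀ {m n} → 2 ^ m ≤ n → m ≤ ⌊log₂ n ⌋
2^m≤n⇒m≤⌊log₂n⌋ {m} p = ≡.subst (_≤ _) (⌊log₂[2^n]⌋≡n m) (⌊log₂⌋-mono-≤ p)

⌊log₂n⌋≡1+⌊log₂⌊n/2⌋⌋ : ∀ n → 2 ≤ n → ⌊log₂ n ⌋ ≡ suc ⌊log₂ ⌊ n /2⌋ ⌋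
⌊log₂n⌋≡1+⌊log₂⌊n/2⌋⌋ n 2≤n = begin
  ⌊log₂ n ⌋              ≡⟨ ≡.sym (m∸n+n≡m (2^m≤n⇒m≤⌊log₂n⌋ {1} 2≤n)) ⟩
  ⌊log₂ n ⌋ ∸ 1 + 1      ≡⟨ ℕ.+-comm _ 1 ⟩
  suc (⌊log₂ n ⌋ ∸ 1)    ≡⟨ ≡.cong suc (≡.sym (⌊log₂⌊n/2⌋⌋≡⌊log₂n⌋∸1 n)) ⟩
  suc ⌊log₂ ⌊ n /2⌋ ⌋    ∎
  where open ≡.≡-Reasoning

⌈log₂n⌉≡1+⌈log₂⌈n/2⌉⌉ : ∀ n → 2 ≤ n → ⌈log₂ n ⌉ ≡ suc ⌈log₂ ⌈ n /2⌉ ⌉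
⌈log₂n⌉≡1+⌈log₂⌈n/2⌉⌉ n 2≤n = begin
  ⌈log₂ n ⌉              ≡⟨ ≡.sym (m∸n+n≡m 1≤⌈log₂n⌉) ⟩
  ⌈log₂ n ⌉ ∸ 1 + 1      ≡⟨ ℕ.+-comm _ 1 ⟩
  suc (⌈log₂ n ⌉ ∸ 1)    ≡⟨ ≡.cong suc (≡.sym (⌈log₂⌈n/2⌉⌉≡⌈log₂n⌉∸1 n)) ⟩
  suc ⌈log₂ ⌈ n /2⌉ ⌉    ∎
  where
  open ≡.≡-Reasoning
  1≤⌈log₂n⌉ : 1 ≤ ⌈log₂ n ⌉
  1≤⌈log₂n⌉ = ≡.subst (_≤ ⌈log₂ n ⌉) (⌈log₂2^n⌉≡n 1) (⌈log₂⌉-mono-≤ 2≤n)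

2^⌊log₂n⌋≤n : ∀ n → 1 ≤ n → 2 ^ ⌊log₂ n ⌋ ≤ n
2^⌊log₂n⌋≤n = <-rec _ go
  where
  open ≤-Reasoning
  go : ∀ n → (∀ {k} → k < n → 1 ≤ k → 2 ^ ⌊log₂ k ⌋ ≤ k) → 1 ≤ n → 2 ^ ⌊log₂ n ⌋ ≤ n
  go 1 _ _ = ≤-refl
  go n@(suc (suc y)) rec _ = begin
    2 ^ ⌊log₂ n ⌋              ≡⟨ ≡.cong (2 ^_) (⌊log₂n⌋≡1+⌊log₂⌊n/2⌋⌋ n (s≤s (s≤s z≤n))) ⟩
    2 * 2 ^ ⌊log₂ ⌊ n /2⌋ ⌋    ≤⟨ *-monoʳ-≤ 2 (rec (⌊n/2⌋<n (suc y)) (s≤s z≤n)) ⟩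
    2 * ⌊ n /2⌋                ≡⟨ ≡.cong (⌊ n /2⌋ +_) (ℕ.+-identityʳ _) ⟩
    ⌊ n /2⌋ + ⌊ n /2⌋          ≤⟨ +-monoʳ-≤ ⌊ n /2⌋ (⌊n/2⌋≤⌈n/2⌉ n) ⟩
    ⌊ n /2⌋ + ⌈ n /2⌉          ≡⟨ ⌊n/2⌋+⌈n/2⌉≡n n ⟩
    n                          ∎

n≤2^⌈log₂n⌉ : ∀ n → n ≤ 2 ^ ⌈log₂ n ⌉
n≤2^⌈log₂n⌉ = <-rec _ go
  where
  open ≤-Reasoning
  go : ∀ n → (∀ {k} → k < n → k ≤ 2 ^ ⌈log₂ k ⌉) → n ≤ 2 ^ ⌈log₂ n ⌉
  go 0 _ = z≤n
  go 1 _ = s≤s z≤n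
  go n@(suc (suc y)) rec = begin
    n                          ≡⟨ ≡.sym (⌊n/2⌋+⌈n/2⌉≡n n) ⟩
    ⌊ n /2⌋ + ⌈ n /2⌉          ≤⟨ +-monoˡ-≤ ⌈ n /2⌉ (⌊n/2⌋≤⌈n/2⌉ n) ⟩
    ⌈ n /2⌉ + ⌈ n /2⌉          ≡⟨ ≡.cong (⌈ n /2⌉ +_) (≡.sym (ℕ.+-identityʳ _)) ⟩
    2 * ⌈ n /2⌉                ≤⟨ *-monoʳ-≤ 2 (rec (⌈n/2⌉<n y)) ⟩
    2 * 2 ^ ⌈log₂ ⌈ n /2⌉ ⌉    ≡⟨ ≡.cong (2 ^_) (≡.sym (⌈log₂n⌉≡1+⌈log₂⌈n/2⌉⌉ n (s≤s (s≤s z≤n)))) ⟩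
    2 ^ ⌈log₂ n ⌉              ∎

n<2^m⇒⌊log₂n⌋<m : ∀ {n m} → 1 ≤ n → n < 2 ^ m → ⌊log₂ n ⌋ < m
n<2^m⇒⌊log₂n⌋<m {n} {m} 1≤n n<2^m with ⌊log₂ n ⌋ <? m
... | yes lt = lt
... | no ≮  = ⊥-elim (<⇒≱ n<2^m (≤-trans (^-monoʳ-≤ 2 (≮⇒≥ ≮)) (2^⌊log₂n⌋≤n n 1≤n)))

n<2^[1+⌊log₂n⌋] : ∀ n → n < 2 ^ suc ⌊log₂ n ⌋
n<2^[1+⌊log₂n⌋] n with 2 ^ suc ⌊log₂ n ⌋ ≤? n
... | no ≰  = ≰⇒> ≰
... | yes p = ⊥-elim (<⇒≱ (n<1+n _) (2^m≤n⇒m≤⌊log₂n⌋ p))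

⌈log₂n⌉≤n : ∀ n → ⌈log₂ n ⌉ ≤ n
⌈log₂n⌉≤n n = ≡.subst (⌈log₂ n ⌉ ≤_) (⌈log₂2^n⌉≡n n) (⌈log₂⌉-mono-≤ (<⇒≤ (n<2^n n)))

⌊log₂n⌋≤⌈log₂n⌉ : ∀ n → 1 ≤ n → ⌊log₂ n ⌋ ≤ ⌈log₂ n ⌉
⌊log₂n⌋≤⌈log₂n⌉ n 1≤n =
  ≡.subst (_≤ ⌈log₂ n ⌉) (⌈log₂2^n⌉≡n _) (⌈log₂⌉-mono-≤ (2^⌊log₂n⌋≤n n 1≤n))

2^m∣2^n : ∀ {m n} → m ≤ n → 2 ^ m ∣ 2 ^ n
2^m∣2^n {m} {n} m≤n = divides (2 ^ (n ∸ m))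
  (≡.trans (≡.cong (2 ^_) (≡.sym (m∸n+n≡m m≤n))) (^-distribˡ-+-* 2 (n ∸ m) m))

rev-zero : ∀ k → rev k 0 ≡ 0
rev-zero zero    = refl
rev-zero (suc k) = rev-zero k

/2<2^ : ∀ {s} k → s < 2 ^ suc k → s / 2 < 2 ^ k
/2<2^ {s} k lt = m<n*o⇒m/o<n (≡.subst (s <_) (ℕ.*-comm 2 (2 ^ k)) lt)

rev-suc : ∀ k s → s < 2 ^ k → rev (suc k) s ≡ 2 * rev k s
rev-suc zero    zero    _        = refl
rev-suc zero    (suc s) (s≤s ())
rev-suc (suc k) s       lt       = begin
  (s % 2) * (2 * 2 ^ k) + rev (suc k) (s / 2)  ≡⟨ ≡.cong ((s % 2) * (2 * 2 ^ k) +_) (rev-suc k (s / 2) (/2<2^ k lt)) ⟩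
  (s % 2) * (2 * 2 ^ k) + 2 * rev k (s / 2)    ≡⟨ solve 3 (λ b p x → b :* (con 2 :* p) :+ con 2 :* x := con 2 :* (b :* p :+ x))
                                                        refl (s % 2) (2 ^ k) (rev k (s / 2)) ⟩
  2 * ((s % 2) * 2 ^ k + rev k (s / 2))        ∎
  where
  open ≡.≡-Reasoning
  open +-*-Solver

rev-+ : ∀ d k s → s < 2 ^ k → rev (d + k) s ≡ 2 ^ d * rev k s
rev-+ zero    k s lt = ≡.sym (ℕ.+-identityʳ _)
rev-+ (suc d) k s lt = begin
  rev (suc (d + k)) s    ≡⟨ rev-suc (d + k) s (<-≤-trans lt (^-monoʳ-≤ 2 (m≤n+m k d))) ⟩
  2 * rev (d + k) s      ≡⟨ ≡.cong (2 *_) (rev-+ d k s lt) ⟩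
  2 * (2 ^ d * rev k s)  ≡⟨ ≡.sym (ℕ.*-assoc 2 (2 ^ d) _) ⟩
  2 ^ suc d * rev k s    ∎
  where open ≡.≡-Reasoning

-- Adding t < 2^ℓ to a multiple of 2^ℓ only touches the low ℓ bits, so no carry occurs.
rev-+-multiple : ∀ k ℓ c t → t < 2 ^ ℓ → rev k (c * 2 ^ ℓ + t) ≡ rev k (c * 2 ^ ℓ) + rev k t
rev-+-multiple zero    ℓ       c t       lt       = refl
rev-+-multiple (suc k) zero    c zero    lt
  rewrite ℕ.+-identityʳ (c * 1) | rev-zero k = ≡.sym (ℕ.+-identityʳ _)
rev-+-multiple (suc k) zero    c (suc t) (s≤s ())
rev-+-multiple (suc k) (suc ℓ) c t       lt       = begin
  rev (suc k) (c * 2 ^ suc ℓ + t)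
    ≡⟨ ≡.cong (λ z → rev (suc k) (z + t)) c2^ℓ*2 ⟩
  ((a * 2 + t) % 2) * 2 ^ k + rev k ((a * 2 + t) / 2)
    ≡⟨ ≡.cong₂ (λ u v → u * 2 ^ k + rev k v) low high ⟩
  (t % 2) * 2 ^ k + rev k (a + t / 2)
    ≡⟨ ≡.cong ((t % 2) * 2 ^ k +_) (rev-+-multiple k ℓ c (t / 2) (/2<2^ ℓ lt)) ⟩
  (t % 2) * 2 ^ k + (rev k a + rev k (t / 2))
    ≡⟨ solve 3 (λ x y z → x :+ (y :+ z) := y :+ (x :+ z)) refl ((t % 2) * 2 ^ k) (rev k a) (rev k (t / 2)) ⟩
  rev k a + rev (suc k) t
    ≡⟨ ≡.cong₂ (λ u v → u * 2 ^ k + rev k v + rev (suc k) t) (≡.sym (m*n%n≡0 a 2)) (≡.sym (m*n/n≡m a 2)) ⟩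
  rev (suc k) (a * 2) + rev (suc k) t
    ≡⟨ ≡.cong (λ z → rev (suc k) z + rev (suc k) t) (≡.sym c2^ℓ*2) ⟩
  rev (suc k) (c * 2 ^ suc ℓ) + rev (suc k) t
    ∎
  where
  open ≡.≡-Reasoning
  open +-*-Solver
  a = c * 2 ^ ℓ
  c2^ℓ*2 : c * 2 ^ suc ℓ ≡ a * 2
  c2^ℓ*2 = ≡.trans (≡.cong (c *_) (ℕ.*-comm 2 (2 ^ ℓ))) (≡.sym (ℕ.*-assoc c (2 ^ ℓ) 2))
  low : (a * 2 + t) % 2 ≡ t % 2
  low = ≡.trans (≡.cong (_% 2) (ℕ.+-comm (a * 2) t)) ([m+kn]%n≡m%n t a 2)
  high : (a * 2 + t) / 2 ≡ a + t / 2
  high = ≡.trans (+-distrib-/-∣ˡ t (divides a refl)) (≡.cong (_+ t / 2) (m*n/n≡m a 2))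

⌊log₂[2^k+n]⌋≤k⇒n<2^k : ∀ k n → ⌊log₂ (2 ^ k + n) ⌋ ≤ k → n < 2 ^ k
⌊log₂[2^k+n]⌋≤k⇒n<2^k k n lg≤k = +-cancelˡ-< (2 ^ k) n (2 ^ k) (begin-strict
  2 ^ k + n                          <⟨ n<2^[1+⌊log₂n⌋] (2 ^ k + n) ⟩
  2 ^ suc ⌊log₂ (2 ^ k + n) ⌋        ≤⟨ ^-monoʳ-≤ 2 (s≤s lg≤k) ⟩
  2 ^ suc k                          ≡⟨ ≡.cong (2 ^ k +_) (ℕ.+-identityʳ _) ⟩
  2 ^ k + 2 ^ k                      ∎)
  where open ≤-Reasoning

m∸n≡suc[m∸suc[n]] : ∀ m n → n < m → m ∸ n ≡ suc (m ∸ suc n)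
m∸n≡suc[m∸suc[n]] (suc m) zero    _         = refl
m∸n≡suc[m∸suc[n]] (suc m) (suc n) (s≤s n<m) = m∸n≡suc[m∸suc[n]] m n n<m

if-T : ∀ {a} {A : Set a} {b} {x y : A} → T b → (if b then x else y) ≡ x
if-T {b = true} _ = refl

if-¬T : ∀ {a} {A : Set a} {b} {x y : A} → ¬ T b → (if b then x else y) ≡ y
if-¬T {b = true}  ¬t = ⊥-elim (¬t _)
if-¬T {b = false} _  = refl

¬T<ᵇ : ∀ {m n} → n ≤ m → ¬ T (m <ᵇ n)
¬T<ᵇ {m} {n} n≤m t = <⇒≱ (<ᵇ⇒< m n t) n≤m

¬T[n<ᵇn] : ∀ n → ¬ T (n <ᵇ n)
¬T[n<ᵇn] n = ¬T<ᵇ {n} ≤-refl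

Outside : ℕ → ℕ → ℕ → Set
Outside o len j = j < o ⊎ o + len ≤ j

Outside-≢ : ∀ {o len j t} → Outside o len j → t < len → j ≢ o + t
Outside-≢ {o} {t = t} (inj₁ j<o)     _     refl = <⇒≱ j<o (m≤m+n o t)
Outside-≢ {o}         (inj₂ o+len≤j) t<len refl = <⇒≱ (+-monoʳ-< o t<len) o+len≤j

Outside-shrink : ∀ {o len len′ j} → len′ ≤ len → Outside o len j → Outside o len′ j
Outside-shrink     _        (inj₁ j<o)     = inj₁ j<o
Outside-shrink {o} len′≤len (inj₂ o+len≤j) = inj₂ (≤-trans (+-monoʳ-≤ o len′≤len) o+len≤j)

module _ {c ℓ : Level} (R : CommutativeRing c ℓ) where
  open CommutativeRing R renaming (_+_ to _+ᴿ_; _*_ to _*ᴿ_; Carrier to C; refl to ≈-refl)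
  open import Algebra.Definitions.RawSemiring (Semiring.rawSemiring semiring) using (sum) renaming (_^_ to _^ᴿ_)
  open import Algebra.Properties.Semiring.Exp semiring using (^-homo-*; ^-assocʳ; ^-congˡ)
  open import Algebra.Properties.CommutativeSemiring.Exp commutativeSemiring using (^-distrib-*)
  open import Algebra.Solver.Ring.NaturalCoefficients.Default commutativeSemiring
  open import Relation.Binary.Reasoning.Setoid setoid

  ∑ : ℕ → (ℕ → C) → C
  ∑ zero    f = 0#
  ∑ (suc n) f = f 0 +ᴿ ∑ n (λ i → f (suc i))

  sum≡∑ : ∀ n (f : ℕ → C) → sum {n} (λ i → f (toℕ i)) ≡ ∑ n f
  sum≡∑ zero    f = ≡.refl
  sum≡∑ (suc n) f = ≡.cong (f 0 +ᴿ_) (sum≡∑ n (λ i → f (suc i)))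

  ∑-cong : ∀ n {f g : ℕ → C} → (∀ i → i < n → f i ≈ g i) → ∑ n f ≈ ∑ n g
  ∑-cong zero    f≈g = ≈-refl
  ∑-cong (suc n) f≈g = +-cong (f≈g 0 (s≤s z≤n)) (∑-cong n (λ i i<n → f≈g (suc i) (s≤s i<n)))

  ∑-zero : ∀ n {f : ℕ → C} → (∀ i → i < n → f i ≈ 0#) → ∑ n f ≈ 0#
  ∑-zero zero    f≈0 = ≈-refl
  ∑-zero (suc n) f≈0 = trans (+-cong (f≈0 0 (s≤s z≤n)) (∑-zero n (λ i i<n → f≈0 (suc i) (s≤s i<n)))) (+-identityˡ 0#)

  ∑-+ : ∀ n (f g : ℕ → C) → ∑ n (λ i → f i +ᴿ g i) ≈ ∑ n f +ᴿ ∑ n g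
  ∑-+ zero    f g = sym (+-identityˡ 0#)
  ∑-+ (suc n) f g = trans (+-congˡ (∑-+ n _ _)) (solve 4 (λ a b c d → (a :+ b) :+ (c :+ d) := (a :+ c) :+ (b :+ d)) ≈-refl _ _ _ _)

  ∑-*ˡ : ∀ n a (f : ℕ → C) → ∑ n (λ i → a *ᴿ f i) ≈ a *ᴿ ∑ n f
  ∑-*ˡ zero    a f = sym (zeroʳ a)
  ∑-*ˡ (suc n) a f = trans (+-congˡ (∑-*ˡ n a _)) (sym (distribˡ a _ _))

  ∑-last : ∀ n (f : ℕ → C) → ∑ (suc n) f ≈ ∑ n f +ᴿ f n
  ∑-last zero    f = +-comm _ _
  ∑-last (suc n) f = trans (+-congˡ (∑-last n (λ i → f (suc i)))) (sym (+-assoc _ _ _))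

  ∑-changeAt : ∀ n k (f g e : ℕ → C) c → k < n → (∀ i → i < n → ¬ i ≡ k → f i ≈ g i) → f k ≈ g k +ᴿ c →
               ∑ n (λ i → f i *ᴿ e i) ≈ ∑ n (λ i → g i *ᴿ e i) +ᴿ c *ᴿ e k
  ∑-changeAt (suc n) zero f g e c _ f≈g fk≈ = begin
    f 0 *ᴿ e 0 +ᴿ ∑ n (λ i → f (suc i) *ᴿ e (suc i))
      ≈⟨ +-cong (*-congʳ fk≈) (∑-cong n (λ i i<n → *-congʳ (f≈g (suc i) (s≤s i<n) (λ ())))) ⟩
    (g 0 +ᴿ c) *ᴿ e 0 +ᴿ ∑ n (λ i → g (suc i) *ᴿ e (suc i))
      ≈⟨ solve 4 (λ a c e s → (a :+ c) :* e :+ s := (a :* e :+ s) :+ c :* e) ≈-refl _ _ _ _ ⟩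
    (g 0 *ᴿ e 0 +ᴿ ∑ n (λ i → g (suc i) *ᴿ e (suc i))) +ᴿ c *ᴿ e 0
      ∎
  ∑-changeAt (suc n) (suc k) f g e c (s≤s k<n) f≈g fk≈ = trans
    (+-cong (*-congʳ (f≈g 0 (s≤s z≤n) (λ ())))
            (∑-changeAt n k _ _ _ c k<n (λ i i<n i≢k → f≈g (suc i) (s≤s i<n) (λ eq → i≢k (ℕ.suc-injective eq))) fk≈))
    (sym (+-assoc _ _ _))

  eval : ℕ → (ℕ → C) → C → C
  eval n f y = ∑ n (λ i → f i *ᴿ y ^ᴿ i)

  evalPoly≡eval : ∀ n f y → evalPoly R n f y ≡ eval n f y
  evalPoly≡eval n f y = sum≡∑ n (λ i → f i *ᴿ y ^ᴿ i)

  eval-cong : ∀ n {f g : ℕ → C} y → (∀ i → i < n → f i ≈ g i) → eval n f y ≈ eval n g y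
  eval-cong n y f≈g = ∑-cong n (λ i i<n → *-congʳ (f≈g i i<n))

  eval-congʳ : ∀ n (f : ℕ → C) {y y′} → y ≈ y′ → eval n f y ≈ eval n f y′
  eval-congʳ n f y≈y′ = ∑-cong n (λ i _ → *-congˡ (^-congˡ i y≈y′))

  eval-zero : ∀ n (f : ℕ → C) y → (∀ i → i < n → f i ≈ 0#) → eval n f y ≈ 0#
  eval-zero n f y f≈0 = ∑-zero n (λ i i<n → trans (*-congʳ (f≈0 i i<n)) (zeroˡ _))

  eval-suc : ∀ n (f : ℕ → C) y → eval (suc n) f y ≈ f 0 +ᴿ y *ᴿ eval n (λ i → f (suc i)) y
  eval-suc n f y = +-cong (*-identityʳ (f 0)) (begin
    ∑ n (λ i → f (suc i) *ᴿ (y *ᴿ y ^ᴿ i))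
      ≈⟨ ∑-cong n (λ i _ → solve 3 (λ a y b → a :* (y :* b) := y :* (a :* b)) ≈-refl (f (suc i)) y (y ^ᴿ i)) ⟩
    ∑ n (λ i → y *ᴿ (f (suc i) *ᴿ y ^ᴿ i))  ≈⟨ ∑-*ˡ n y _ ⟩
    y *ᴿ eval n (λ i → f (suc i)) y         ∎)

  eval-pad : ∀ n N (f : ℕ → C) y → n ≤ N → (∀ i → n ≤ i → f i ≈ 0#) → eval N f y ≈ eval n f y
  eval-pad zero    N       f y _         f≈0 = eval-zero N f y (λ i _ → f≈0 i z≤n)
  eval-pad (suc n) (suc N) f y (s≤s n≤N) f≈0 = begin
    eval (suc N) f y                         ≈⟨ eval-suc N f y ⟩
    f 0 +ᴿ y *ᴿ eval N (λ i → f (suc i)) y   ≈⟨ +-congˡ (*-congˡ (eval-pad n N _ y n≤N (λ i n≤i → f≈0 (suc i) (s≤s n≤i)))) ⟩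
    f 0 +ᴿ y *ᴿ eval n (λ i → f (suc i)) y   ≈⟨ eval-suc n f y ⟨
    eval (suc n) f y                         ∎

  eval-*-+ : ∀ n a (f g : ℕ → C) y → eval n (λ i → a *ᴿ f i +ᴿ g i) y ≈ a *ᴿ eval n f y +ᴿ eval n g y
  eval-*-+ n a f g y = begin
    ∑ n (λ i → (a *ᴿ f i +ᴿ g i) *ᴿ y ^ᴿ i)
      ≈⟨ ∑-cong n (λ i _ → solve 4 (λ a f g z → (a :* f :+ g) :* z := a :* (f :* z) :+ g :* z) ≈-refl a (f i) (g i) (y ^ᴿ i)) ⟩
    ∑ n (λ i → a *ᴿ (f i *ᴿ y ^ᴿ i) +ᴿ g i *ᴿ y ^ᴿ i)  ≈⟨ ∑-+ n _ _ ⟩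
    ∑ n (λ i → a *ᴿ (f i *ᴿ y ^ᴿ i)) +ᴿ eval n g y     ≈⟨ +-congʳ (∑-*ˡ n a _) ⟩
    a *ᴿ eval n f y +ᴿ eval n g y                      ∎

  convolution : (ℕ → C) → (ℕ → C) → ℕ → C
  convolution f g s = ∑ (suc s) (λ i → f i *ᴿ g (s ∸ i))

  eval-convolution : ∀ m n N (f g : ℕ → C) y → (∀ i → m ≤ i → f i ≈ 0#) → (∀ j → n ≤ j → g j ≈ 0#) →
                     m + n ≤ suc N → eval N (convolution f g) y ≈ eval m f y *ᴿ eval n g y
  eval-convolution zero n N f g y f≈0 _ _ = begin
    eval N (convolution f g) y  ≈⟨ eval-zero N _ y (λ s _ → ∑-zero (suc s) (λ i _ → trans (*-congʳ (f≈0 i z≤n)) (zeroˡ (g (s ∸ i))))) ⟩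
    0#                          ≈⟨ zeroˡ _ ⟨
    0# *ᴿ eval n g y            ∎
  eval-convolution (suc m) n zero f g y _ _ (s≤s m+n≤0) rewrite ℕ.n≤0⇒n≡0 (≤-trans (m≤n+m n m) m+n≤0) =
    sym (zeroʳ _)
  eval-convolution (suc m) n (suc N) f g y f≈0 g≈0 (s≤s m+n≤N) = begin
    eval (suc N) (convolution f g) y
      ≈⟨ eval-suc N (convolution f g) y ⟩
    convolution f g 0 +ᴿ y *ᴿ eval N (λ s → f 0 *ᴿ g (suc s) +ᴿ convolution f⁺ g s) y
      ≈⟨ +-cong (+-identityʳ _) (*-congˡ (eval-*-+ N (f 0) (λ s → g (suc s)) (convolution f⁺ g) y)) ⟩
    f 0 *ᴿ g 0 +ᴿ y *ᴿ (f 0 *ᴿ G⁺ +ᴿ eval N (convolution f⁺ g) y)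
      ≈⟨ +-congˡ (*-congˡ (+-congˡ (eval-convolution m n N f⁺ g y (λ i m≤i → f≈0 (suc i) (s≤s m≤i)) g≈0 m+n≤N))) ⟩
    f 0 *ᴿ g 0 +ᴿ y *ᴿ (f 0 *ᴿ G⁺ +ᴿ F⁺ *ᴿ eval n g y)
      ≈⟨ +-congˡ (*-congˡ (+-congˡ (*-congˡ G≈))) ⟩
    f 0 *ᴿ g 0 +ᴿ y *ᴿ (f 0 *ᴿ G⁺ +ᴿ F⁺ *ᴿ (g 0 +ᴿ y *ᴿ G⁺))
      ≈⟨ solve 5 (λ a b y G F → a :* b :+ y :* (a :* G :+ F :* (b :+ y :* G)) := (a :+ y :* F) :* (b :+ y :* G)) ≈-refl (f 0) (g 0) y G⁺ F⁺ ⟩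
    (f 0 +ᴿ y *ᴿ F⁺) *ᴿ (g 0 +ᴿ y *ᴿ G⁺)
      ≈⟨ *-cong (eval-suc m f y) G≈ ⟨
    eval (suc m) f y *ᴿ eval n g y
      ∎
    where
    f⁺ = λ i → f (suc i)
    G⁺ = eval N (λ s → g (suc s)) y
    F⁺ = eval m f⁺ y
    G≈ : eval n g y ≈ g 0 +ᴿ y *ᴿ G⁺
    G≈ = trans (sym (eval-pad n (suc N) g y (≤-trans (m≤n+m n m) m+n≤N) g≈0)) (eval-suc N g y)

  1^n≈1 : ∀ n → 1# ^ᴿ n ≈ 1#
  1^n≈1 zero    = ≈-refl
  1^n≈1 (suc n) = trans (*-identityˡ _) (1^n≈1 n)

  ^-mod2^ : ∀ ℓ y i → y ^ᴿ (2 ^ ℓ) ≈ 1# → y ^ᴿ i ≈ y ^ᴿ mod2^ i ℓ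
  ^-mod2^ ℓ y i y^L≈1 = begin
    y ^ᴿ i                              ≡⟨ ≡.cong (y ^ᴿ_) (m≡m%n+[m/n]*n i L) ⟩
    y ^ᴿ (i % L + i / L * L)            ≈⟨ ^-homo-* y (i % L) _ ⟩
    y ^ᴿ (i % L) *ᴿ y ^ᴿ (i / L * L)    ≡⟨ ≡.cong (λ e → y ^ᴿ (i % L) *ᴿ y ^ᴿ e) (ℕ.*-comm (i / L) L) ⟩
    y ^ᴿ (i % L) *ᴿ y ^ᴿ (L * (i / L))  ≈⟨ *-congˡ (^-assocʳ y L (i / L)) ⟨
    y ^ᴿ (i % L) *ᴿ (y ^ᴿ L) ^ᴿ (i / L) ≈⟨ *-congˡ (trans (^-congˡ (i / L) y^L≈1) (1^n≈1 (i / L))) ⟩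
    y ^ᴿ (i % L) *ᴿ 1#                  ≈⟨ *-identityʳ _ ⟩
    y ^ᴿ (i % L)                        ∎
    where
    L = 2 ^ ℓ
    instance _ = ℕ.m^n≢0 2 ℓ

  -- w^i computed as the machine does, by p ← p·w from p = 1, so that machine states match definitionally.
  powers : C → ℕ → C
  powers w zero    = 1#
  powers w (suc i) = powers w i *ᴿ w

  powers≈^ : ∀ w i → powers w i ≈ w ^ᴿ i
  powers≈^ w zero    = ≈-refl
  powers≈^ w (suc i) = trans (*-congʳ (powers≈^ w i)) (*-comm _ _)

  eval-powers-* : ∀ n w (f : ℕ → C) y → eval n (λ i → powers w i *ᴿ f i) y ≈ eval n f (w *ᴿ y)
  eval-powers-* n w f y = ∑-cong n (λ i _ → begin
    powers w i *ᴿ f i *ᴿ y ^ᴿ i  ≈⟨ *-congʳ (*-congʳ (powers≈^ w i)) ⟩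
    w ^ᴿ i *ᴿ f i *ᴿ y ^ᴿ i      ≈⟨ solve 3 (λ a b c → a :* b :* c := b :* (a :* c)) ≈-refl _ _ _ ⟩
    f i *ᴿ (w ^ᴿ i *ᴿ y ^ᴿ i)    ≈⟨ *-congˡ (^-distrib-* w y i) ⟨
    f i *ᴿ (w *ᴿ y) ^ᴿ i         ∎)

  horner : (ℕ → C) → ℕ → C → ℕ → C
  horner f N y zero    = 0#
  horner f N y (suc j) = horner f N y j *ᴿ y +ᴿ f (N ∸ suc j)

  horner≈eval : ∀ f N y j → j ≤ N → horner f N y j ≈ eval j (λ i → f (N ∸ j + i)) y
  horner≈eval f N y zero    _   = ≈-refl
  horner≈eval f N y (suc j) j<N = begin
    horner f N y j *ᴿ y +ᴿ f (N ∸ suc j)                    ≈⟨ +-congʳ (*-congʳ (horner≈eval f N y j (<⇒≤ j<N))) ⟩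
    eval j (λ i → f (N ∸ j + i)) y *ᴿ y +ᴿ f (N ∸ suc j)  ≈⟨ trans (+-comm _ _) (+-congˡ (*-comm _ _)) ⟩
    f (N ∸ suc j) +ᴿ y *ᴿ eval j (λ i → f (N ∸ j + i)) y
      ≈⟨ +-cong (reflexive (≡.cong f (≡.sym (ℕ.+-identityʳ _))))
                (*-congˡ (eval-cong j y (λ i _ → reflexive (≡.cong f (≡.trans (≡.cong (_+ i) (m∸n≡suc[m∸suc[n]] N j j<N))
                                                                                 (≡.sym (+-suc _ i))))))) ⟩
    f (N ∸ suc j + 0) +ᴿ y *ᴿ eval j (λ i → f (N ∸ suc j + suc i)) y  ≈⟨ eval-suc j (λ i → f (N ∸ suc j + i)) y ⟨
    eval (suc j) (λ i → f (N ∸ suc j + i)) y                          ∎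

  horner-complete : ∀ f N y → horner f N y N ≈ eval N f y
  horner-complete f N y = trans (horner≈eval f N y N ≤-refl)
    (eval-cong N y (λ i _ → reflexive (≡.cong (λ k → f (k + i)) (n∸n≡0 N))))

module _ {c ℓ : Level} (R : CommutativeRing c ℓ) where
  open CommutativeRing R renaming (_+_ to _+ᴿ_; _*_ to _*ᴿ_; Carrier to C; refl to ≈-refl)
  open import Algebra.Definitions.RawSemiring (Semiring.rawSemiring semiring) using () renaming (_^_ to _^ᴿ_)
  open import Relation.Binary.Reasoning.Setoid setoid

  ext-vanishes : ∀ {k} (F : Fin k → C) i → k ≤ i → ext R F i ≈ 0#
  ext-vanishes {zero}  F i       _         = ≈-refl
  ext-vanishes {suc k} F (suc i) (s≤s k≤i) = ext-vanishes (λ j → F (Fin.suc j)) i k≤i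

  upd-same : ∀ X k v → upd R X k v k ≡ v
  upd-same X k v = if-T (≡⇒≡ᵇ k k refl)

  upd-other : ∀ X k v j → j ≢ k → upd R X k v j ≡ X j
  upd-other X k v j j≢k = if-¬T (λ t → j≢k (≡ᵇ⇒≡ j k t))

  blit-inside : ∀ X off len Y t → t < len → blit R X off len Y (off + t) ≡ Y t
  blit-inside X off len Y t t<len = ≡.trans
    (if-T (Equivalence.from T-∧ (<⇒<ᵇ (s≤s (m≤m+n off t)) , <⇒<ᵇ (+-monoʳ-< off t<len))))
    (≡.cong Y (m+n∸m≡n off t))

  blit-outside : ∀ X off len Y j → Outside off len j → blit R X off len Y j ≡ X j
  blit-outside X off len Y j (inj₁ j<off) =
    if-¬T (λ t → ¬T<ᵇ j<off (proj₁ (Equivalence.to (T-∧ {off <ᵇ suc j}) t)))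
  blit-outside X off len Y j (inj₂ off+len≤j) =
    if-¬T (λ t → ¬T<ᵇ off+len≤j (proj₂ (Equivalence.to (T-∧ {off <ᵇ suc j}) t)))

  zeroFill : (ℕ → C) → ℕ → ℕ → ℕ → C
  zeroFill X o zero    = X
  zeroFill X o (suc d) = upd R (zeroFill X o d) (o + d) 0#

  zeroFill-outside : ∀ X o d j → Outside o d j → zeroFill X o d j ≡ X j
  zeroFill-outside X o zero    j _   = refl
  zeroFill-outside X o (suc d) j out = ≡.trans
    (upd-other (zeroFill X o d) _ _ j (Outside-≢ out (n<1+n d)))
    (zeroFill-outside X o d j (Outside-shrink (n≤1+n d) out))

  zeroFill-inside : ∀ X o d t → t < d → zeroFill X o d (o + t) ≡ 0#
  zeroFill-inside X o (suc d) t t<1+d with m≤n⇒m<n∨m≡n (≤-pred t<1+d)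
  ... | inj₂ refl = upd-same (zeroFill X o t) (o + t) 0#
  ... | inj₁ t<d  = ≡.trans (upd-other (zeroFill X o d) _ _ (o + t) (λ eq → <⇒≢ t<d (+-cancelˡ-≡ o t d eq)))
                            (zeroFill-inside X o d t t<d)

  pointwiseMul : (ℕ → C) → ℕ → ℕ → ℕ → ℕ → C
  pointwiseMul X o L zero    = X
  pointwiseMul X o L (suc d) =
    upd R (pointwiseMul X o L d) (o + d) (pointwiseMul X o L d (o + d) *ᴿ pointwiseMul X o L d (o + L + d))

  pointwiseMul-outside : ∀ X o L d j → Outside o d j → pointwiseMul X o L d j ≡ X j
  pointwiseMul-outside X o L zero    j _   = refl
  pointwiseMul-outside X o L (suc d) j out = ≡.trans
    (upd-other (pointwiseMul X o L d) _ _ j (Outside-≢ out (n<1+n d)))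
    (pointwiseMul-outside X o L d j (Outside-shrink (n≤1+n d) out))

  pointwiseMul-inside : ∀ X o L d t → t < d → pointwiseMul X o L d (o + t) ≡ X (o + t) *ᴿ X (o + L + t)
  pointwiseMul-inside X o L (suc d) t t<1+d with m≤n⇒m<n∨m≡n (≤-pred t<1+d)
  ... | inj₂ refl = ≡.trans (upd-same (pointwiseMul X o L t) (o + t) _)
      (≡.cong₂ _*ᴿ_ (pointwiseMul-outside X o L t (o + t) (inj₂ ≤-refl))
                    (pointwiseMul-outside X o L t (o + L + t) (inj₂ (+-monoˡ-≤ t (m≤m+n o L)))))
  ... | inj₁ t<d  = ≡.trans (upd-other (pointwiseMul X o L d) _ _ (o + t) (λ eq → <⇒≢ t<d (+-cancelˡ-≡ o t d eq)))
                            (pointwiseMul-inside X o L d t t<d)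

  -- Accumulates the coefficients of Σ_(i<d) w^i f_i x^i modulo x^(2^ℓ) − 1 into X_o, …, X_(o+2^ℓ−1).
  foldMod : (ℕ → C) → ℕ → (ℕ → C) → C → ℕ → ℕ → ℕ → C
  foldMod X o f w ℓ zero    = X
  foldMod X o f w ℓ (suc d) =
    upd R (foldMod X o f w ℓ d) (o + mod2^ d ℓ) (foldMod X o f w ℓ d (o + mod2^ d ℓ) +ᴿ powers R w d *ᴿ f d)

  mod2^<2^ : ∀ i ℓ → mod2^ i ℓ < 2 ^ ℓ
  mod2^<2^ i ℓ = m%n<n i (2 ^ ℓ) {{m^n≢0 2 ℓ}}

  foldMod-outside : ∀ X o f w ℓ d j → Outside o (2 ^ ℓ) j → foldMod X o f w ℓ d j ≡ X j
  foldMod-outside X o f w ℓ zero    j _   = refl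
  foldMod-outside X o f w ℓ (suc d) j out = ≡.trans
    (upd-other (foldMod X o f w ℓ d) _ _ j (Outside-≢ out (mod2^<2^ d ℓ)))
    (foldMod-outside X o f w ℓ d j out)

  -- At a point y with y^(2^ℓ) = 1, reducing modulo x^(2^ℓ) − 1 does not change the value.
  eval-foldMod : ∀ X o f w ℓ d y → y ^ᴿ (2 ^ ℓ) ≈ 1# → (∀ t → t < 2 ^ ℓ → X (o + t) ≈ 0#) →
                 eval R (2 ^ ℓ) (λ t → foldMod X o f w ℓ d (o + t)) y ≈ eval R d (λ i → powers R w i *ᴿ f i) y
  eval-foldMod X o f w ℓ zero    y _      X≈0 = eval-zero R (2 ^ ℓ) _ y X≈0
  eval-foldMod X o f w ℓ (suc d) y y^L≈1 X≈0 = begin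
    eval R L (λ t → foldMod X o f w ℓ (suc d) (o + t)) y
      ≈⟨ ∑-changeAt R L k _ (λ t → foldMod X o f w ℓ d (o + t)) (y ^ᴿ_) term (mod2^<2^ d ℓ)
           (λ t _ t≢k → reflexive (upd-other (foldMod X o f w ℓ d) _ _ (o + t) (λ eq → t≢k (+-cancelˡ-≡ o t k eq))))
           (reflexive (upd-same (foldMod X o f w ℓ d) (o + k) _)) ⟩
    eval R L (λ t → foldMod X o f w ℓ d (o + t)) y +ᴿ term *ᴿ y ^ᴿ k
      ≈⟨ +-cong (eval-foldMod X o f w ℓ d y y^L≈1 X≈0) (*-congˡ (sym (^-mod2^ R ℓ y d y^L≈1))) ⟩
    eval R d (λ i → powers R w i *ᴿ f i) y +ᴿ term *ᴿ y ^ᴿ d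
      ≈⟨ ∑-last R d _ ⟨
    eval R (suc d) (λ i → powers R w i *ᴿ f i) y
      ∎
    where
    L = 2 ^ ℓ
    k = mod2^ d ℓ
    term = powers R w d *ᴿ f d

module RootsOfUnity {c ℓ : Level} (R : CommutativeRing c ℓ) (ω : ℕ → CommutativeRing.Carrier R) (K : ℕ)
  (ω-primitive : ∀ k → K ≤ k → PrimitiveRoot2^ R k (ω k))
  (ω-compatible : ∀ k → K ≤ k → CommutativeRing._≈_ R (CommutativeRing._*_ R (ω (suc k)) (ω (suc k))) (ω k)) where

  open CommutativeRing R renaming (_+_ to _+ᴿ_; _*_ to _*ᴿ_; Carrier to C; refl to ≈-refl)
  open import Algebra.Definitions.RawSemiring (Semiring.rawSemiring semiring) using () renaming (_^_ to _^ᴿ_)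
  open import Algebra.Properties.Semiring.Exp semiring using (^-homo-*; ^-assocʳ; ^-congˡ)
  open import Relation.Binary.Reasoning.Setoid setoid

  Ω : ℕ → C
  Ω = omegaIdx R ω K

  level : ℕ → ℕ
  level s = K ⊔ ⌈log₂ (suc s) ⌉

  s<2^level : ∀ s → s < 2 ^ level s
  s<2^level s = ≤-trans (n≤2^⌈log₂n⌉ (suc s)) (^-monoʳ-≤ 2 (m≤n⊔m K _))

  -- One more bit of bit reversal doubles the exponent, and ω_[j+1]^2 = ω_[j].
  ω^rev-+ : ∀ d k s → K ≤ k → s < 2 ^ k → ω (d + k) ^ᴿ rev (d + k) s ≈ ω k ^ᴿ rev k s
  ω^rev-+ zero    k s _   _      = ≈-refl
  ω^rev-+ (suc d) k s K≤k s<2^k = begin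
    ω′ ^ᴿ rev (suc (d + k)) s  ≡⟨ ≡.cong (ω′ ^ᴿ_) (rev-suc (d + k) s (<-≤-trans s<2^k (^-monoʳ-≤ 2 (m≤n+m k d)))) ⟩
    ω′ ^ᴿ (2 * rev (d + k) s)  ≈⟨ ^-assocʳ ω′ 2 (rev (d + k) s) ⟨
    (ω′ ^ᴿ 2) ^ᴿ rev (d + k) s ≈⟨ ^-congˡ (rev (d + k) s) ω′²≈ω ⟩
    ω (d + k) ^ᴿ rev (d + k) s ≈⟨ ω^rev-+ d k s K≤k s<2^k ⟩
    ω k ^ᴿ rev k s             ∎
    where
    ω′ = ω (suc (d + k))
    ω′²≈ω : ω′ ^ᴿ 2 ≈ ω (d + k)
    ω′²≈ω = trans (*-congˡ (*-identityʳ ω′)) (ω-compatible (d + k) (≤-trans K≤k (m≤n+m k d)))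

  Ω≈ω^rev : ∀ s k → level s ≤ k → Ω s ≈ ω k ^ᴿ rev k s
  Ω≈ω^rev s k level≤k = ≡.subst (λ k′ → Ω s ≈ ω k′ ^ᴿ rev k′ s) (m∸n+n≡m level≤k)
    (sym (ω^rev-+ (k ∸ level s) (level s) s (m≤m⊔n K _) (s<2^level s)))

  Ω-*-Ω : ∀ ℓ q t → 2 ^ ℓ ∣ q → t < 2 ^ ℓ → Ω q *ᴿ Ω t ≈ Ω (q + t)
  Ω-*-Ω ℓ q@._ t (divides c refl) t<2^ℓ = begin
    Ω q *ᴿ Ω t                         ≈⟨ *-cong (Ω≈ω^rev q k (≤-trans (m≤m⊔n _ _) (m≤m⊔n _ _)))
                                                 (Ω≈ω^rev t k (≤-trans (m≤n⊔m (level q) _) (m≤m⊔n _ _))) ⟩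
    ω k ^ᴿ rev k q *ᴿ ω k ^ᴿ rev k t   ≈⟨ ^-homo-* (ω k) (rev k q) (rev k t) ⟨
    ω k ^ᴿ (rev k q + rev k t)         ≡⟨ ≡.cong (ω k ^ᴿ_) (rev-+-multiple k ℓ c t t<2^ℓ) ⟨
    ω k ^ᴿ rev k (q + t)               ≈⟨ Ω≈ω^rev (q + t) k (m≤n⊔m (level q ⊔ level t) (level (q + t))) ⟨
    Ω (q + t)                          ∎
    where k = level q ⊔ level t ⊔ level (q + t)

  -- With k = level t + ℓ, ω_t = ω_[k]^(2^(level t) · rev_ℓ t), so its 2^ℓ-th power is a power of ω_[k]^(2^k) = 1.
  Ω^2^ℓ≈1 : ∀ ℓ t → t < 2 ^ ℓ → Ω t ^ᴿ (2 ^ ℓ) ≈ 1#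
  Ω^2^ℓ≈1 ℓ t t<2^ℓ = begin
    Ω t ^ᴿ L                              ≈⟨ ^-congˡ L (Ω≈ω^rev t k (m≤m+n _ _)) ⟩
    (ω k ^ᴿ rev k t) ^ᴿ L                 ≈⟨ ^-assocʳ (ω k) (rev k t) L ⟩
    ω k ^ᴿ (rev k t * L)                  ≡⟨ ≡.cong (λ e → ω k ^ᴿ (e * L)) (rev-+ (level t) ℓ t t<2^ℓ) ⟩
    ω k ^ᴿ (2 ^ level t * rev ℓ t * L)    ≡⟨ ≡.cong (ω k ^ᴿ_) exponent ⟩
    ω k ^ᴿ (2 ^ k * rev ℓ t)              ≈⟨ ^-assocʳ (ω k) (2 ^ k) (rev ℓ t) ⟨
    (ω k ^ᴿ 2 ^ k) ^ᴿ rev ℓ t              ≈⟨ ^-congˡ (rev ℓ t) (proj₁ (ω-primitive k (≤-trans (m≤m⊔n K _) (m≤m+n _ _)))) ⟩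
    1# ^ᴿ rev ℓ t                         ≈⟨ 1^n≈1 R (rev ℓ t) ⟩
    1#                                    ∎
    where
    L = 2 ^ ℓ
    k = level t + ℓ
    exponent : 2 ^ level t * rev ℓ t * L ≡ 2 ^ k * rev ℓ t
    exponent = ≡.trans (solve 3 (λ a r L → a :* r :* L := a :* L :* r) refl (2 ^ level t) (rev ℓ t) L)
                       (≡.cong (_* rev ℓ t) (≡.sym (^-distribˡ-+-* 2 (level t) ℓ)))
      where open +-*-Solver

module Traces {a} {S : Set a} (step : S → S) (cost : S → ℕ) (Good : S → Set) where

  iter : ℕ → S → S
  iter zero    s = s
  iter (suc d) s = step (iter d s)

  costOf : ℕ → S → ℕ
  costOf zero    s = 0
  costOf (suc d) s = costOf d s + cost (iter d s)

  iter-+ : ∀ d₂ d₁ s → iter (d₂ + d₁) s ≡ iter d₂ (iter d₁ s)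
  iter-+ zero     d₁ s = refl
  iter-+ (suc d₂) d₁ s = ≡.cong step (iter-+ d₂ d₁ s)

  costOf-+ : ∀ d₂ d₁ s → costOf (d₂ + d₁) s ≡ costOf d₁ s + costOf d₂ (iter d₁ s)
  costOf-+ zero     d₁ s = ≡.sym (ℕ.+-identityʳ _)
  costOf-+ (suc d₂) d₁ s = ≡.trans
    (≡.cong₂ _+_ (costOf-+ d₂ d₁ s) (≡.cong cost (iter-+ d₂ d₁ s)))
    (ℕ.+-assoc (costOf d₁ s) _ _)

  Trace : S → ℕ → S → ℕ → Set a
  Trace s d s′ c = (iter d s ≡ s′) × (costOf d s ≤ c) × (∀ j → j ≤ d → Good (iter j s))

  trace-end : ∀ {s d s′ c} → Trace s d s′ c → Good s′
  trace-end {d = d} (reach , _ , good) = ≡.subst Good reach (good d ≤-refl)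

  trace-weaken : ∀ {s d s′ c c′} → c ≤ c′ → Trace s d s′ c → Trace s d s′ c′
  trace-weaken c≤c′ (reach , cost≤ , good) = reach , ≤-trans cost≤ c≤c′ , good

  trace-step : ∀ s s′ → step s ≡ s′ → Good s → Good s′ → Trace s 1 s′ (cost s)
  trace-step s s′ reach good-s good-s′ = reach , ≤-refl , good
    where
    good : ∀ j → j ≤ 1 → Good (iter j s)
    good zero          _ = good-s
    good (suc zero)    _ = ≡.subst Good (≡.sym reach) good-s′
    good (suc (suc j)) (s≤s ())

  infixl 5 _++_
  _++_ : ∀ {s d₁ s₁ c₁ d₂ s₂ c₂} → Trace s d₁ s₁ c₁ → Trace s₁ d₂ s₂ c₂ → Trace s (d₂ + d₁) s₂ (c₁ + c₂)
  _++_ {s} {d₁} {s₁} {c₁} {d₂} {s₂} {c₂} (reach₁ , cost₁ , good₁) (reach₂ , cost₂ , good₂) =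
      ≡.trans (iter-+ d₂ d₁ s) (≡.trans (≡.cong (iter d₂) reach₁) reach₂)
    , ≡.subst (_≤ c₁ + c₂) (≡.sym (costOf-+ d₂ d₁ s))
        (+-mono-≤ cost₁ (≡.subst (λ s′ → costOf d₂ s′ ≤ c₂) (≡.sym reach₁) cost₂))
    , good
    where
    good : ∀ j → j ≤ d₂ + d₁ → Good (iter j s)
    good j j≤d with j ≤? d₁
    ... | yes j≤d₁ = good₁ j j≤d₁
    ... | no  j≰d₁ = ≡.subst Good iter≡ (good₂ (j ∸ d₁) (≡.subst (j ∸ d₁ ≤_) (m+n∸n≡m d₂ d₁) (∸-monoˡ-≤ d₁ j≤d)))
      where
      iter≡ : iter (j ∸ d₁) s₁ ≡ iter j s
      iter≡ = ≡.trans (≡.cong (iter (j ∸ d₁)) (≡.sym reach₁))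
                (≡.trans (≡.sym (iter-+ (j ∸ d₁) d₁ s)) (≡.cong (λ k → iter k s) (m∸n+n≡m (<⇒≤ (≰⇒> j≰d₁)))))

  trace-loop : ∀ (F : ℕ → S) D → (∀ j → j < D → step (F j) ≡ F (suc j)) →
               (∀ j → j < D → cost (F j) ≡ 1) → (∀ j → j ≤ D → Good (F j)) → Trace (F 0) D (F D) D
  trace-loop F D steps costs goods =
    reach D ≤-refl , ≤-reflexive (costs≡ D ≤-refl) , (λ j j≤D → ≡.subst Good (≡.sym (reach j j≤D)) (goods j j≤D))
    where
    reach : ∀ j → j ≤ D → iter j (F 0) ≡ F j
    reach zero    _   = refl
    reach (suc j) j<D = ≡.trans (≡.cong step (reach j (<⇒≤ j<D))) (steps j j<D)
    costs≡ : ∀ j → j ≤ D → costOf j (F 0) ≡ j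
    costs≡ zero    _   = refl
    costs≡ (suc j) j<D = ≡.trans (≡.cong₂ _+_ (costs≡ j (<⇒≤ j<D)) (≡.trans (≡.cong cost (reach j (<⇒≤ j<D))) (costs j j<D)))
                                 (ℕ.+-comm j 1)

-- The costs of one iteration in order: loop test, zeroing 2L cells, computing ω_q, folding m coefficients,
-- an FFT of length L = 2^ℓ at cost L(ℓ+1) = L e, folding n coefficients, the second FFT, L products.
iteration-cost≤ : ∀ L e m n cw Λ K → e ≤ Λ → cw ≤ K + Λ + 1 →
  1 + (L + L) + 1 + cw + m + 1 + L * e + n + 1 + L * e + L + 1 ≤ (3 + 2 * Λ) * L + (m + n + K + Λ + 6)
iteration-cost≤ L e m n cw Λ K e≤Λ cw≤ = begin
  1 + (L + L) + 1 + cw + m + 1 + L * e + n + 1 + L * e + L + 1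
    ≡⟨ solve 5 (λ L e m n cw → con 1 :+ (L :+ L) :+ con 1 :+ cw :+ m :+ con 1 :+ L :* e :+ n :+ con 1 :+ L :* e :+ L :+ con 1
                := (con 3 :* L :+ con 2 :* (L :* e)) :+ (m :+ n :+ cw :+ con 5)) refl L e m n cw ⟩
  (3 * L + 2 * (L * e)) + (m + n + cw + 5)
    ≤⟨ +-mono-≤ (+-monoʳ-≤ (3 * L) (*-monoʳ-≤ 2 (*-monoʳ-≤ L e≤Λ))) (+-monoˡ-≤ 5 (+-monoʳ-≤ (m + n) cw≤)) ⟩
  (3 * L + 2 * (L * Λ)) + (m + n + (K + Λ + 1) + 5)
    ≡⟨ solve 5 (λ L K m n Λ → (con 3 :* L :+ con 2 :* (L :* Λ)) :+ (m :+ n :+ (K :+ Λ :+ con 1) :+ con 5)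
                := (con 3 :+ con 2 :* Λ) :* L :+ (m :+ n :+ K :+ Λ :+ con 6)) refl L K m n Λ ⟩
  (3 + 2 * Λ) * L + (m + n + K + Λ + 6)
    ∎
  where
  open ≤-Reasoning
  open +-*-Solver

-- An upper bound for the loop started with x = r − q cells left, when each iteration costs at most P L + M.
-- The overhead M is paid at most twice per value of ⌊log₂ x⌋, as two iterations at least halve x.
loopCost : ℕ → ℕ → ℕ → ℕ
loopCost P M x = 2 * ⌊log₂ x ⌋ * M + P * (x ∸ 1) + 1

loopCost-one-iteration : ∀ P M L x x′ μ → ⌊log₂ x ⌋ ≡ suc μ → x ∸ 1 ≡ L + (x′ ∸ 1) → ⌊log₂ x′ ⌋ ≤ μ →
  (P * L + M) + loopCost P M x′ ≤ loopCost P M x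
loopCost-one-iteration P M L x x′ μ lg≡ x∸1≡ lg′≤ = begin
  (P * L + M) + (2 * ⌊log₂ x′ ⌋ * M + P * y + 1)
    ≤⟨ +-monoʳ-≤ (P * L + M) (+-monoˡ-≤ 1 (+-monoˡ-≤ (P * y) (*-monoˡ-≤ M (*-monoʳ-≤ 2 lg′≤)))) ⟩
  (P * L + M) + (2 * μ * M + P * y + 1)
    ≤⟨ m≤m+n _ M ⟩
  (P * L + M) + (2 * μ * M + P * y + 1) + M
    ≡⟨ solve 5 (λ P M L y μ → (P :* L :+ M) :+ (con 2 :* μ :* M :+ P :* y :+ con 1) :+ M
                := con 2 :* (con 1 :+ μ) :* M :+ P :* (L :+ y) :+ con 1) refl P M L y μ ⟩
  2 * suc μ * M + P * (L + y) + 1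
    ≡⟨ ≡.cong₂ (λ a b → 2 * a * M + P * b + 1) (≡.sym lg≡) (≡.sym x∸1≡) ⟩
  loopCost P M x
    ∎
  where
  open ≤-Reasoning
  open +-*-Solver
  y = x′ ∸ 1

loopCost-two-iterations : ∀ P M L x x″ μ → ⌊log₂ x ⌋ ≡ suc μ → x ∸ 1 ≡ L + (L + (x″ ∸ 1)) → ⌊log₂ x″ ⌋ ≤ μ →
  (P * L + M) + ((P * L + M) + loopCost P M x″) ≤ loopCost P M x
loopCost-two-iterations P M L x x″ μ lg≡ x∸1≡ lg″≤ = begin
  (P * L + M) + ((P * L + M) + (2 * ⌊log₂ x″ ⌋ * M + P * y + 1))
    ≤⟨ +-monoʳ-≤ (P * L + M) (+-monoʳ-≤ (P * L + M) (+-monoˡ-≤ 1 (+-monoˡ-≤ (P * y) (*-monoˡ-≤ M (*-monoʳ-≤ 2 lg″≤))))) ⟩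
  (P * L + M) + ((P * L + M) + (2 * μ * M + P * y + 1))
    ≡⟨ solve 5 (λ P M L y μ → (P :* L :+ M) :+ ((P :* L :+ M) :+ (con 2 :* μ :* M :+ P :* y :+ con 1))
                := con 2 :* (con 1 :+ μ) :* M :+ P :* (L :+ (L :+ y)) :+ con 1) refl P M L y μ ⟩
  2 * suc μ * M + P * (L + (L + y)) + 1
    ≡⟨ ≡.cong₂ (λ a b → 2 * a * M + P * b + 1) (≡.sym lg≡) (≡.sym x∸1≡) ⟩
  loopCost P M x
    ∎
  where
  open ≤-Reasoning
  open +-*-Solver
  y = x″ ∸ 1

polynomial-bound : ∀ S K Λ → Λ ≤ S → 1 ≤ S →
  2 * (Λ * Λ) + 2 * (K * Λ) + 13 * Λ + K + 5 + 5 * S + 5 * (S * Λ) ≤ (3 * K + 30) * S * (Λ + 1)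
polynomial-bound S K Λ Λ≤S 1≤S = begin
  2 * (Λ * Λ) + 2 * (K * Λ) + 13 * Λ + K + 5 + 5 * S + 5 * (S * Λ)
    ≤⟨ +-monoˡ-≤ (5 * (S * Λ)) (+-monoˡ-≤ (5 * S) (+-mono-≤ (+-mono-≤ (+-mono-≤ (+-mono-≤
         (*-monoʳ-≤ 2 (*-monoˡ-≤ Λ Λ≤S)) (*-monoʳ-≤ 2 (*-monoʳ-≤ K Λ≤SΛ))) (*-monoʳ-≤ 13 Λ≤SΛ)) K≤KS)
         (*-monoʳ-≤ 5 1≤S))) ⟩
  2 * (S * Λ) + 2 * (K * (S * Λ)) + 13 * (S * Λ) + K * S + 5 * S + 5 * S + 5 * (S * Λ)
    ≤⟨ m≤m+n _ (K * (S * Λ) + 2 * (K * S) + 10 * (S * Λ) + 20 * S) ⟩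
  2 * (S * Λ) + 2 * (K * (S * Λ)) + 13 * (S * Λ) + K * S + 5 * S + 5 * S + 5 * (S * Λ)
    + (K * (S * Λ) + 2 * (K * S) + 10 * (S * Λ) + 20 * S)
    ≡⟨ solve 3 (λ S K Λ → con 2 :* (S :* Λ) :+ con 2 :* (K :* (S :* Λ)) :+ con 13 :* (S :* Λ) :+ K :* S :+ con 5 :* S
                            :+ con 5 :* S :+ con 5 :* (S :* Λ) :+ (K :* (S :* Λ) :+ con 2 :* (K :* S) :+ con 10 :* (S :* Λ) :+ con 20 :* S)
                := (con 3 :* K :+ con 30) :* S :* (Λ :+ con 1)) refl S K Λ ⟩
  (3 * K + 30) * S * (Λ + 1)
    ∎
  where
  open ≤-Reasoning
  open +-*-Solver
  Λ≤SΛ : Λ ≤ S * Λ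
  Λ≤SΛ = ≡.subst (_≤ S * Λ) (ℕ.+-identityʳ Λ) (*-monoˡ-≤ Λ 1≤S)
  K≤KS : K ≤ K * S
  K≤KS = ≡.subst (_≤ K * S) (ℕ.*-identityʳ K) (*-monoʳ-≤ K 1≤S)

-- The loop from q = 0, then computing ω_(r−1), two Horner evaluations, one product and the ITFT of length r.
total-cost≤ : ∀ m n K Λ lg r−1 r lgc cw → lg ≤ Λ → r−1 ≤ m + n → r ≤ m + n → lgc ≤ Λ → cw ≤ K + Λ →
  Λ ≤ m + n → 1 ≤ m + n →
  (2 * lg * (m + n + K + Λ + 6) + (3 + 2 * Λ) * r−1 + 1) + (cw + 1 + m + 1 + n + 1 + 1 + r * (lgc + 1))
    ≤ (3 * K + 30) * (m + n) * (Λ + 1)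
total-cost≤ m n K Λ lg r−1 r lgc cw lg≤ r−1≤ r≤ lgc≤ cw≤ Λ≤S 1≤S = begin
  (2 * lg * (S + K + Λ + 6) + (3 + 2 * Λ) * r−1 + 1) + (cw + 1 + m + 1 + n + 1 + 1 + r * (lgc + 1))
    ≤⟨ +-mono-≤ (+-monoˡ-≤ 1 (+-mono-≤ (*-monoˡ-≤ (S + K + Λ + 6) (*-monoʳ-≤ 2 lg≤)) (*-monoʳ-≤ (3 + 2 * Λ) r−1≤)))
                (+-mono-≤ (+-monoˡ-≤ 1 (+-monoˡ-≤ 1 (+-monoˡ-≤ n (+-monoˡ-≤ 1 (+-monoˡ-≤ m (+-monoˡ-≤ 1 cw≤))))))
                          (*-mono-≤ r≤ (+-monoˡ-≤ 1 lgc≤))) ⟩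
  (2 * Λ * (S + K + Λ + 6) + (3 + 2 * Λ) * S + 1) + (K + Λ + 1 + m + 1 + n + 1 + 1 + S * (Λ + 1))
    ≡⟨ solve 4 (λ m n K Λ → (con 2 :* Λ :* (m :+ n :+ K :+ Λ :+ con 6) :+ (con 3 :+ con 2 :* Λ) :* (m :+ n) :+ con 1)
                              :+ (K :+ Λ :+ con 1 :+ m :+ con 1 :+ n :+ con 1 :+ con 1 :+ (m :+ n) :* (Λ :+ con 1))
                := con 2 :* (Λ :* Λ) :+ con 2 :* (K :* Λ) :+ con 13 :* Λ :+ K :+ con 5 :+ con 5 :* (m :+ n) :+ con 5 :* ((m :+ n) :* Λ))
                refl m n K Λ ⟩
  2 * (Λ * Λ) + 2 * (K * Λ) + 13 * Λ + K + 5 + 5 * S + 5 * (S * Λ)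
    ≤⟨ polynomial-bound S K Λ Λ≤S 1≤S ⟩
  (3 * K + 30) * S * (Λ + 1)
    ∎
  where
  open ≤-Reasoning
  open +-*-Solver
  S = m + n

module Correctness {c ℓ′ : Level} (R : CommutativeRing c ℓ′)
  (ω : ℕ → CommutativeRing.Carrier R) (K : ℕ)
  (ω-primitive : ∀ k → K ≤ k → PrimitiveRoot2^ R k (ω k))
  (ω-compatible : ∀ k → K ≤ k → CommutativeRing._≈_ R (CommutativeRing._*_ R (ω (suc k)) (ω (suc k))) (ω k))
  (fft itft : ℕ → (ℕ → CommutativeRing.Carrier R) → ℕ → CommutativeRing.Carrier R)
  (fft-spec : FFTSpec R ω K fft) (itft-spec : ITFTSpec R ω K itft) where

  open CommutativeRing R renaming (_+_ to _+ᴿ_; _*_ to _*ᴿ_; Carrier to C; refl to ≈-refl)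
  open RootsOfUnity R ω K ω-primitive ω-compatible
  module ≈-Reasoning = Relation.Binary.Reasoning.Setoid setoid

  foldTransform : (ℕ → C) → ℕ → ℕ → ℕ → (ℕ → C) → ℕ → ℕ → C
  foldTransform Y q ℓ o f d =
    let folded = foldMod R Y o f (Ω q) ℓ d in blit R folded o (2 ^ ℓ) (fft (2 ^ ℓ) (λ u → folded (o + u)))

  foldTransform-outside : ∀ Y q ℓ o f d j → Outside o (2 ^ ℓ) j → foldTransform Y q ℓ o f d j ≡ Y j
  foldTransform-outside Y q ℓ o f d j out =
    ≡.trans (blit-outside R folded o (2 ^ ℓ) (fft (2 ^ ℓ) (λ u → folded (o + u))) j out)
            (foldMod-outside R Y o f (Ω q) ℓ d j out)
    where folded = foldMod R Y o f (Ω q) ℓ d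

  -- F(ω_t) = A(ω_q ω_t) = A(ω_(q+t)) for the reduction F of A(ω_q x) modulo x^(2^ℓ) − 1.
  foldTransform-inside : ∀ Y q ℓ o f d t → 2 ^ ℓ ∣ q → (∀ u → u < 2 ^ ℓ → Y (o + u) ≈ 0#) → t < 2 ^ ℓ →
                         foldTransform Y q ℓ o f d (o + t) ≈ eval R d f (Ω (q + t))
  foldTransform-inside Y q ℓ o f d t 2^ℓ∣q Y≈0 t<L = begin
    foldTransform Y q ℓ o f d (o + t)                   ≡⟨ blit-inside R folded o L (fft L (λ u → folded (o + u))) t t<L ⟩
    fft L (λ u → folded (o + u)) t                      ≈⟨ fft-spec ℓ (λ u → folded (o + u)) t t<L ⟩
    evalPoly R L (λ u → folded (o + u)) (Ω t)           ≡⟨ evalPoly≡eval R L (λ u → folded (o + u)) (Ω t) ⟩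
    eval R L (λ u → folded (o + u)) (Ω t)               ≈⟨ eval-foldMod R Y o f (Ω q) ℓ d (Ω t) (Ω^2^ℓ≈1 ℓ t t<L) Y≈0 ⟩
    eval R d (λ i → powers R (Ω q) i *ᴿ f i) (Ω t)      ≈⟨ eval-powers-* R d (Ω q) f (Ω t) ⟩
    eval R d f (Ω q *ᴿ Ω t)                             ≈⟨ eval-congʳ R d f (Ω-*-Ω ℓ q t 2^ℓ∣q t<L) ⟩
    eval R d f (Ω (q + t))                              ∎
    where
    open ≈-Reasoning
    L = 2 ^ ℓ
    folded = foldMod R Y o f (Ω q) ℓ d

  module Product {m n : ℕ} (1≤m : 1 ≤ m) (1≤n : 1 ≤ n) (A : Fin m → C) (B : Fin n → C) where
    open Machine R ω K fft itft A B

    Bounded : State R → Set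
    Bounded s = State.q s ≤ m + n × State.l s ≤ m + n × State.i s ≤ m + n

    open Traces step cost Bounded public

    run≡iter : ∀ t X₀ → run t X₀ ≡ iter t (init X₀)
    run≡iter zero    X₀ = refl
    run≡iter (suc t) X₀ = ≡.cong step (run≡iter t X₀)

    totalCost≡costOf : ∀ t X₀ → totalCost t X₀ ≡ costOf t (init X₀)
    totalCost≡costOf zero    X₀ = refl
    totalCost≡costOf (suc t) X₀ = ≡.cong₂ _+_ (totalCost≡costOf t X₀) (≡.cong cost (run≡iter t X₀))

    1≤m+n : 1 ≤ m + n
    1≤m+n = ≤-trans 1≤m (m≤m+n m n)

    r≤m+n : r ≤ m + n
    r≤m+n = ≤-trans (m∸n≤m (n + m) 1) (≤-reflexive (ℕ.+-comm n m))

    1≤r : 1 ≤ r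
    1≤r = m+n≤o⇒m≤o∸n 1 (+-mono-≤ 1≤n 1≤m)

    Λ P M : ℕ
    Λ = ⌈log₂ (m + n) ⌉
    P = 3 + 2 * Λ
    M = m + n + K + Λ + 6

    -- C(ω_s), which PRODUCT stores in X_s before the final interpolation
    Ĉ : ℕ → C
    Ĉ s = eval R m A′ (Ω s) *ᴿ eval R n B′ (Ω s)

    -- Every block length the loop can still choose from q on divides q.
    Aligned : ℕ → Set
    Aligned q = ∀ e → 2 ^ suc e ≤ r ∸ q → 2 ^ e ∣ q

    record LoopInvariant (q l i : ℕ) (X : ℕ → C) : Set ℓ′ where
      field
        q<r     : q < r
        aligned : Aligned q
        l≤m+n   : l ≤ m + n
        i≤m+n   : i ≤ m + n
        prefix  : ∀ j → j < q → X j ≈ Ĉ j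

    module Iteration (q l₀ i₀ : ℕ) (w₀ p₀ a₀ b₀ : C) (X : ℕ → C) (1+q<r : suc q < r)
                     (inv : LoopInvariant q l₀ i₀ X) where
      open LoopInvariant inv

      x μ ℓ L : ℕ
      x = r ∸ q
      μ = ⌊log₂ x ⌋
      ℓ = μ ∸ 1
      L = 2 ^ ℓ

      2≤x : 2 ≤ x
      2≤x = m+n≤o⇒m≤o∸n 2 1+q<r

      μ≡1+ℓ : μ ≡ suc ℓ
      μ≡1+ℓ = ≡.sym (≡.trans (ℕ.+-comm 1 ℓ) (m∸n+n≡m (2^m≤n⇒m≤⌊log₂n⌋ {1} 2≤x)))

      2^μ≡L+L : 2 ^ μ ≡ L + L
      2^μ≡L+L = ≡.trans (≡.cong (2 ^_) μ≡1+ℓ) (≡.cong (L +_) (ℕ.+-identityʳ L))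

      2^μ≤x : 2 ^ μ ≤ x
      2^μ≤x = 2^⌊log₂n⌋≤n x (≤-trans (s≤s z≤n) 2≤x)

      L+L≤x : L + L ≤ x
      L+L≤x = ≡.subst (_≤ x) 2^μ≡L+L 2^μ≤x

      q+[L+L]≤r : q + (L + L) ≤ r
      q+[L+L]≤r = ≡.subst (_≤ r) (ℕ.+-comm (L + L) q) (m≤o∸n⇒m+n≤o (L + L) (<⇒≤ (<-trans (n<1+n q) 1+q<r)) L+L≤x)

      q+L+L≤r : q + L + L ≤ r
      q+L+L≤r = ≡.subst (_≤ r) (≡.sym (ℕ.+-assoc q L L)) q+[L+L]≤r

      q+L≤r : q + L ≤ r
      q+L≤r = ≤-trans (m≤m+n (q + L) L) q+L+L≤r

      1≤L : 1 ≤ L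
      1≤L = m^n>0 2 ℓ

      L+L≤m+n : L + L ≤ m + n
      L+L≤m+n = ≤-trans L+L≤x (≤-trans (m∸n≤m r q) r≤m+n)

      L≤m+n : L ≤ m + n
      L≤m+n = ≤-trans (m≤m+n L L) L+L≤m+n

      bounded : ∀ {i} → i ≤ m + n → q ≤ m + n × ℓ ≤ m + n × i ≤ m + n
      bounded i≤ = ≤-trans (<⇒≤ q<r) r≤m+n , ≤-trans (<⇒≤ (n<2^n ℓ)) L≤m+n , i≤

      2^ℓ∣q : 2 ^ ℓ ∣ q
      2^ℓ∣q = aligned ℓ (≡.subst (λ k → 2 ^ k ≤ x) μ≡1+ℓ 2^μ≤x)

      w : C
      w = Ω q

      zeroed transformedA transformedB multiplied : ℕ → C
      zeroed       = zeroFill R X q (L + L)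
      transformedA = foldTransform zeroed q ℓ q A′ m
      transformedB = foldTransform transformedA q ℓ (q + L) B′ n
      multiplied   = pointwiseMul R transformedB q L L

      current loadingW transformingA transformingB next : State R
      zeroing foldingA foldingB multiplying : ℕ → State R
      current       = st loopHead q l₀ i₀ w₀ p₀ a₀ b₀ X
      zeroing j     = st zeroX q ℓ j w₀ p₀ a₀ b₀ (zeroFill R X q j)
      loadingW      = st loadW q ℓ (L + L) w₀ p₀ a₀ b₀ zeroed
      foldingA j    = st addA q ℓ j w (powers R w j) a₀ b₀ (foldMod R zeroed q A′ w ℓ j)
      transformingA = st fft1 q ℓ m w (powers R w m) a₀ b₀ (foldMod R zeroed q A′ w ℓ m)
      foldingB j    = st addB q ℓ j w (powers R w j) a₀ b₀ (foldMod R transformedA (q + L) B′ w ℓ j)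
      transformingB = st fft2 q ℓ n w (powers R w n) a₀ b₀ (foldMod R transformedA (q + L) B′ w ℓ n)
      multiplying j = st mulX q ℓ j w (powers R w n) a₀ b₀ (pointwiseMul R transformedB q L j)
      next          = st loopHead (q + L) ℓ L w (powers R w n) a₀ b₀ multiplied

      enter : Trace current 1 (zeroing 0) 1
      enter = trace-step _ _ (if-T (<⇒<ᵇ 1+q<r)) (≤-trans (<⇒≤ q<r) r≤m+n , l≤m+n , i≤m+n) (bounded z≤n)

      zero-block : Trace (zeroing 0) (L + L) (zeroing (L + L)) (L + L)
      zero-block = trace-loop zeroing (L + L)
        (λ j j<2L → ≡.trans (if-T (<⇒<ᵇ j<2L)) (if-T (<⇒<ᵇ (<-≤-trans (+-monoʳ-< q j<2L) q+[L+L]≤r))))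
        (λ _ _ → refl) (λ j j≤2L → bounded (≤-trans j≤2L L+L≤m+n))

      zero-exit : Trace (zeroing (L + L)) 1 loadingW 1
      zero-exit = trace-step _ _ (if-¬T (¬T[n<ᵇn] (L + L))) (bounded L+L≤m+n) (bounded L+L≤m+n)

      load-ω : Trace loadingW 1 (foldingA 0) (cost loadingW)
      load-ω = trace-step _ _ refl (bounded L+L≤m+n) (bounded z≤n)

      fold-A : Trace (foldingA 0) m (foldingA m) m
      fold-A = trace-loop foldingA m
        (λ j j<m → ≡.trans (if-T (<⇒<ᵇ j<m)) (if-T (<⇒<ᵇ (<-≤-trans (+-monoʳ-< q (mod2^<2^ R j ℓ)) q+L≤r))))
        (λ _ _ → refl) (λ j j≤m → bounded (≤-trans j≤m (m≤m+n m n)))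

      fold-A-exit : Trace (foldingA m) 1 transformingA 1
      fold-A-exit = trace-step _ _ (if-¬T (¬T[n<ᵇn] m)) (bounded (m≤m+n m n)) (bounded (m≤m+n m n))

      fft-A : Trace transformingA 1 (foldingB 0) (L * (ℓ + 1))
      fft-A = trace-step _ _ (if-T (<⇒<ᵇ (s≤s q+L≤r))) (bounded (m≤m+n m n)) (bounded z≤n)

      fold-B : Trace (foldingB 0) n (foldingB n) n
      fold-B = trace-loop foldingB n
        (λ j j<n → ≡.trans (if-T (<⇒<ᵇ j<n)) (if-T (<⇒<ᵇ (<-≤-trans (+-monoʳ-< (q + L) (mod2^<2^ R j ℓ)) q+L+L≤r))))
        (λ _ _ → refl) (λ j j≤n → bounded (≤-trans j≤n (m≤n+m n m)))

      fold-B-exit : Trace (foldingB n) 1 transformingB 1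
      fold-B-exit = trace-step _ _ (if-¬T (¬T[n<ᵇn] n)) (bounded (m≤n+m n m)) (bounded (m≤n+m n m))

      fft-B : Trace transformingB 1 (multiplying 0) (L * (ℓ + 1))
      fft-B = trace-step _ _ (if-T (<⇒<ᵇ (s≤s q+L+L≤r))) (bounded (m≤n+m n m)) (bounded z≤n)

      multiply : Trace (multiplying 0) L (multiplying L) L
      multiply = trace-loop multiplying L
        (λ j j<L → ≡.trans (if-T (<⇒<ᵇ j<L)) (if-T (<⇒<ᵇ (<-≤-trans (+-monoʳ-< (q + L) j<L) q+L+L≤r))))
        (λ _ _ → refl) (λ j j≤L → bounded (≤-trans j≤L L≤m+n))

      multiply-exit : Trace (multiplying L) 1 next 1
      multiply-exit = trace-step _ _ (if-¬T (¬T[n<ᵇn] L)) (bounded L≤m+n)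
        (≤-trans q+L≤r r≤m+n , proj₂ (bounded L≤m+n))

      ℓ+1≤Λ : ℓ + 1 ≤ Λ
      ℓ+1≤Λ = ≡.subst (_≤ Λ) (≡.trans μ≡1+ℓ (ℕ.+-comm 1 ℓ))
        (≤-trans (⌊log₂⌋-mono-≤ (≤-trans (m∸n≤m r q) r≤m+n)) (⌊log₂n⌋≤⌈log₂n⌉ (m + n) 1≤m+n))

      cost-load-ω≤ : cost loadingW ≤ K + Λ + 1
      cost-load-ω≤ = +-monoˡ-≤ 1 (≤-trans (m⊔n≤m+n K _) (+-monoʳ-≤ K (⌈log₂⌉-mono-≤ (≤-trans (<⇒≤ 1+q<r) r≤m+n))))

      trace : Trace current _ next (P * L + M)
      trace = trace-weaken (iteration-cost≤ L (ℓ + 1) m n _ Λ K ℓ+1≤Λ cost-load-ω≤)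
        (enter ++ zero-block ++ zero-exit ++ load-ω ++ fold-A ++ fold-A-exit ++ fft-A
               ++ fold-B ++ fold-B-exit ++ fft-B ++ multiply ++ multiply-exit)

      zeroed-block : ∀ u → u < L + L → zeroed (q + u) ≈ 0#
      zeroed-block u u<2L = reflexive (zeroFill-inside R X q (L + L) u u<2L)

      transformedA-block : ∀ t → t < L → transformedA (q + t) ≈ eval R m A′ (Ω (q + t))
      transformedA-block t t<L = foldTransform-inside zeroed q ℓ q A′ m t 2^ℓ∣q
        (λ u u<L → zeroed-block u (<-≤-trans u<L (m≤m+n L L))) t<L

      transformedB-block : ∀ t → t < L → transformedB (q + L + t) ≈ eval R n B′ (Ω (q + t))
      transformedB-block t t<L = foldTransform-inside transformedA q ℓ (q + L) B′ n t 2^ℓ∣q zero-above t<L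
        where
        zero-above : ∀ u → u < L → transformedA (q + L + u) ≈ 0#
        zero-above u u<L = trans
          (reflexive (≡.trans (foldTransform-outside zeroed q ℓ q A′ m (q + L + u) (inj₂ (m≤m+n (q + L) u)))
                              (≡.cong zeroed (ℕ.+-assoc q L u))))
          (zeroed-block (L + u) (+-monoʳ-< L u<L))

      multiplied-block : ∀ t → t < L → multiplied (q + t) ≈ Ĉ (q + t)
      multiplied-block t t<L = trans (reflexive (pointwiseMul-inside R transformedB q L L t t<L))
        (*-cong (trans (reflexive (foldTransform-outside transformedA q ℓ (q + L) B′ n (q + t) (inj₁ (+-monoʳ-< q t<L))))
                       (transformedA-block t t<L))
                (transformedB-block t t<L))

      multiplied-prefix : ∀ j → j < q → multiplied j ≡ X j
      multiplied-prefix j j<q = begin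
        multiplied j    ≡⟨ pointwiseMul-outside R transformedB q L L j (inj₁ j<q) ⟩
        transformedB j  ≡⟨ foldTransform-outside transformedA q ℓ (q + L) B′ n j (inj₁ (<-≤-trans j<q (m≤m+n q L))) ⟩
        transformedA j  ≡⟨ foldTransform-outside zeroed q ℓ q A′ m j (inj₁ j<q) ⟩
        zeroed j        ≡⟨ zeroFill-outside R X q (L + L) j (inj₁ j<q) ⟩
        X j             ∎
        where open ≡.≡-Reasoning

      x≡L+x′ : x ≡ L + (r ∸ (q + L))
      x≡L+x′ = ≡.trans (≡.sym (m+[n∸m]≡n (≤-trans (m≤m+n L L) L+L≤x))) (≡.cong (L +_) (∸-+-assoc r q L))

      invariant′ : LoopInvariant (q + L) ℓ L multiplied
      invariant′ = record
        { q<r     = <-≤-trans (m<m+n (q + L) 1≤L) q+L+L≤r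
        ; aligned = aligned′
        ; l≤m+n   = proj₁ (proj₂ (bounded z≤n))
        ; i≤m+n   = L≤m+n
        ; prefix  = prefix′
        }
        where
        aligned′ : Aligned (q + L)
        aligned′ e 2^[1+e]≤ = ∣m∣n⇒∣m+n (aligned e 2^[1+e]≤x)
          (2^m∣2^n (≤-pred (≡.subst (suc e ≤_) μ≡1+ℓ (2^m≤n⇒m≤⌊log₂n⌋ 2^[1+e]≤x))))
          where
          2^[1+e]≤x : 2 ^ suc e ≤ x
          2^[1+e]≤x = ≤-trans 2^[1+e]≤ (∸-monoʳ-≤ r (m≤m+n q L))
        prefix′ : ∀ j → j < q + L → multiplied j ≈ Ĉ j
        prefix′ j j<q+L with j <? q
        ... | yes j<q = trans (reflexive (multiplied-prefix j j<q)) (prefix j j<q)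
        ... | no  j≮q = ≡.subst (λ k → multiplied k ≈ Ĉ k) (m+[n∸m]≡n (≮⇒≥ j≮q))
                          (multiplied-block (j ∸ q) (+-cancelˡ-< q (j ∸ q) L
                            (≡.subst (_< q + L) (≡.sym (m+[n∸m]≡n (≮⇒≥ j≮q))) j<q+L)))

      x′ : ℕ
      x′ = r ∸ (q + L)

      1≤x′ : 1 ≤ x′
      1≤x′ = m<n⇒0<n∸m (LoopInvariant.q<r invariant′)

      x∸1≡L+[x′∸1] : x ∸ 1 ≡ L + (x′ ∸ 1)
      x∸1≡L+[x′∸1] = ≡.trans (≡.cong (_∸ 1) x≡L+x′) (+-∸-assoc L 1≤x′)

    record ReachesFinish (s : State R) (budget : ℕ) : Set (c Level.⊔ ℓ′) where
      constructor reaches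
      field
        steps      : ℕ
        l i        : ℕ
        w p a b    : C
        X          : ℕ → C
        trace      : Trace s steps (st finW (r ∸ 1) l i w p a b X) budget
        prefix     : ∀ j → j < r ∸ 1 → X j ≈ Ĉ j

    trace-++-reaches : ∀ {s d s′ c₁ c₂} → Trace s d s′ c₁ → ReachesFinish s′ c₂ → ReachesFinish s (c₁ + c₂)
    trace-++-reaches t (reaches d l i w p a b X t′ prefix) = reaches _ l i w p a b X (t ++ t′) prefix

    reaches-weaken : ∀ {s c₁ c₂} → c₁ ≤ c₂ → ReachesFinish s c₁ → ReachesFinish s c₂
    reaches-weaken c₁≤c₂ (reaches d l i w p a b X t prefix) = reaches d l i w p a b X (trace-weaken c₁≤c₂ t) prefix

    exit : ∀ q l i w p a b X → ¬ suc q < r → LoopInvariant q l i X → ReachesFinish (st loopHead q l i w p a b X) 1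
    exit q l i w p a b X 1+q≮r inv = reaches 1 l i w p a b X
      (≡.subst (λ q′ → Trace (st loopHead q l i w p a b X) 1 (st finW q′ l i w p a b X) 1) q≡r∸1
        (trace-step _ _ (if-¬T (¬T<ᵇ (≮⇒≥ 1+q≮r))) bounded bounded))
      (λ j j<r∸1 → prefix j (≡.subst (j <_) (≡.sym q≡r∸1) j<r∸1))
      where
      open LoopInvariant inv
      q≡r∸1 : q ≡ r ∸ 1
      q≡r∸1 = ≤-antisym (∸-monoˡ-≤ 1 q<r) (∸-monoˡ-≤ 1 (≮⇒≥ 1+q≮r))
      bounded : Bounded (st loopHead q l i w p a b X)
      bounded = ≤-trans (<⇒≤ q<r) r≤m+n , l≤m+n , i≤m+n

    loop : ∀ fuel q l i w p a b X → r ∸ q ≤ fuel → LoopInvariant q l i X →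
           ReachesFinish (st loopHead q l i w p a b X) (loopCost P M (r ∸ q))
    iterate : ∀ fuel q l i w p a b X → r ∸ q ≤ suc fuel → (1+q<r : suc q < r) → LoopInvariant q l i X →
              ReachesFinish (st loopHead q l i w p a b X) (loopCost P M (r ∸ q))

    loop zero       q l i w p a b X x≤0 inv =
      ⊥-elim (<⇒≱ (m<n⇒0<n∸m (LoopInvariant.q<r inv)) x≤0)
    loop (suc fuel) q l i w p a b X x≤ inv with suc q <? r
    ... | no  1+q≮r = reaches-weaken (m≤n+m 1 _) (exit q l i w p a b X 1+q≮r inv)
    ... | yes 1+q<r = iterate fuel q l i w p a b X x≤ 1+q<r inv

    -- Either ⌊log₂⌋ of the remaining length drops after one iteration, or a second iteration with the same L follows.
    iterate fuel q l i w p a b X x≤ 1+q<r inv = by-cases (⌊log₂ I.x′ ⌋ <? I.μ)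
      where
      module I = Iteration q l i w p a b X 1+q<r inv
      L : ℕ
      L = I.L
      x′≤fuel : I.x′ ≤ fuel
      x′≤fuel = ≤-pred (<-≤-trans (≡.subst (I.x′ <_) (≡.sym I.x≡L+x′) (m<n+m I.x′ I.1≤L)) x≤)
      by-cases : Dec (⌊log₂ I.x′ ⌋ < I.μ) → ReachesFinish (st loopHead q l i w p a b X) (loopCost P M (r ∸ q))
      by-cases (yes lg-drops) =
        reaches-weaken (loopCost-one-iteration P M L I.x I.x′ I.ℓ I.μ≡1+ℓ I.x∸1≡L+[x′∸1]
                         (≤-pred (≡.subst (⌊log₂ I.x′ ⌋ <_) I.μ≡1+ℓ lg-drops)))
          (trace-++-reaches I.trace (loop fuel (q + L) I.ℓ L I.w (powers R I.w n) a b I.multiplied x′≤fuel I.invariant′))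
      by-cases (no lg-stays) =
        reaches-weaken (≡.subst (λ L′ → (P * L + M) + ((P * L′ + M) + loopCost P M J.x′) ≤ loopCost P M I.x) (≡.sym L′≡L)
                          (loopCost-two-iterations P M L I.x J.x′ I.ℓ I.μ≡1+ℓ x∸1≡ lg″≤ℓ))
          (trace-++-reaches I.trace (trace-++-reaches J.trace
            (loop fuel (q + L + J.L) J.ℓ J.L J.w (powers R J.w n) a b J.multiplied x″≤fuel J.invariant′)))
        where
        lg′≡μ : ⌊log₂ I.x′ ⌋ ≡ I.μ
        lg′≡μ = ≤-antisym (⌊log₂⌋-mono-≤ (∸-monoʳ-≤ r (m≤m+n q L))) (≮⇒≥ lg-stays)
        1+q+L<r : suc (q + L) < r
        1+q+L<r = m≤o∸n⇒m+n≤o 2 (<⇒≤ (LoopInvariant.q<r I.invariant′))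
          (≤-trans (^-monoʳ-≤ 2 {1} (≡.subst (1 ≤_) (≡.sym (≡.trans lg′≡μ I.μ≡1+ℓ)) (s≤s z≤n)))
                   (2^⌊log₂n⌋≤n I.x′ I.1≤x′))
        module J = Iteration (q + L) I.ℓ L I.w (powers R I.w n) a b I.multiplied 1+q+L<r I.invariant′
        L′≡L : J.L ≡ L
        L′≡L = ≡.cong (λ k → 2 ^ (k ∸ 1)) lg′≡μ
        x≡L+[L+x″] : I.x ≡ L + (L + J.x′)
        x≡L+[L+x″] = ≡.trans I.x≡L+x′ (≡.cong (L +_) (≡.trans J.x≡L+x′ (≡.cong (_+ J.x′) L′≡L)))
        x∸1≡ : I.x ∸ 1 ≡ L + (L + (J.x′ ∸ 1))
        x∸1≡ = ≡.trans I.x∸1≡L+[x′∸1] (≡.cong (L +_) (≡.trans J.x∸1≡L+[x′∸1] (≡.cong (_+ (J.x′ ∸ 1)) L′≡L)))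
        x″≤fuel : J.x′ ≤ fuel
        x″≤fuel = ≤-trans (≤-trans (m≤n+m J.x′ J.L) (≤-reflexive (≡.sym J.x≡L+x′))) x′≤fuel
        x″<2^μ : J.x′ < 2 ^ I.μ
        x″<2^μ = ⌊log₂[2^k+n]⌋≤k⇒n<2^k I.μ J.x′ (≤-reflexive (≡.cong ⌊log₂_⌋
          (≡.trans (≡.cong (_+ J.x′) I.2^μ≡L+L) (≡.trans (ℕ.+-assoc L L J.x′) (≡.sym x≡L+[L+x″])))))
        lg″≤ℓ : ⌊log₂ J.x′ ⌋ ≤ I.ℓ
        lg″≤ℓ = ≤-pred (≡.subst (⌊log₂ J.x′ ⌋ <_) I.μ≡1+ℓ (n<2^m⇒⌊log₂n⌋<m J.1≤x′ x″<2^μ))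

    m+n≤1+r : m + n ≤ suc r
    m+n≤1+r = ≤-reflexive (≡.trans (ℕ.+-comm m n) (≡.sym (≡.trans (ℕ.+-comm 1 r) (m∸n+n≡m (≤-trans 1≤n (m≤m+n n m))))))

    -- Since deg C < r, the first r coefficients of C already give its values.
    evalPoly-product : ∀ t → evalPoly R r (prodCoeff R A B) (Ω t) ≈ Ĉ t
    evalPoly-product t = begin
      evalPoly R r (prodCoeff R A B) (Ω t)
        ≡⟨ evalPoly≡eval R r (prodCoeff R A B) (Ω t) ⟩
      eval R r (prodCoeff R A B) (Ω t)
        ≈⟨ eval-cong R r (Ω t) (λ s _ → reflexive (sum≡∑ R (suc s) (λ i → A′ i *ᴿ B′ (s ∸ i)))) ⟩
      eval R r (convolution R A′ B′) (Ω t)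
        ≈⟨ eval-convolution R m n r A′ B′ (Ω t) (ext-vanishes R A) (ext-vanishes R B) m+n≤1+r ⟩
      Ĉ t
        ∎
      where open ≈-Reasoning

    horner-step-A : ∀ q l i k w p a b X → i ≡ suc k →
      step (st hornA q l i w p a b X) ≡ st hornA q l k w p (a *ᴿ w +ᴿ A′ k) b X
    horner-step-A q l _ k w p a b X refl = refl

    horner-exit-A : ∀ q l i w p a b X → i ≡ 0 → step (st hornA q l i w p a b X) ≡ st hornB q l n w p a 0# X
    horner-exit-A q l _ w p a b X refl = refl

    horner-step-B : ∀ q l i k w p a b X → i ≡ suc k →
      step (st hornB q l i w p a b X) ≡ st hornB q l k w p a (b *ᴿ w +ᴿ B′ k) X
    horner-step-B q l _ k w p a b X refl = refl

    horner-exit-B : ∀ q l i w p a b X → i ≡ 0 → step (st hornB q l i w p a b X) ≡ st finMul q l 0 w p a b X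
    horner-exit-B q l _ w p a b X refl = refl

    record Completes (s : State R) (budget : ℕ) : Set (c Level.⊔ ℓ′) where
      constructor completes
      field
        steps  : ℕ
        final  : State R
        trace  : Trace s steps final budget
        halted : State.pc final ≡ done
        result : ∀ j → j < r → State.X final j ≈ prodCoeff R A B j

    finalCost : ℕ
    finalCost = K ⊔ ⌈log₂ r ⌉ + 1 + m + 1 + n + 1 + 1 + r * (⌈log₂ r ⌉ + 1)

    module Finish {s : State R} {budget : ℕ} (reached : ReachesFinish s budget) where
      open ReachesFinish reached

      W : C
      W = Ω (r ∸ 1)

      evaluatingA evaluatingB : ℕ → State R
      evaluatingA j = st hornA (r ∸ 1) l (m ∸ j) W p (horner R A′ m W j) b X
      evaluatingB j = st hornB (r ∸ 1) l (n ∸ j) W p (horner R A′ m W m) (horner R B′ n W j) X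

      Â B̂ : C
      Â = horner R A′ m W m
      B̂ = horner R B′ n W n

      values : ℕ → C
      values = upd R X (r ∸ 1) (Â *ᴿ B̂)

      multiplying interpolating halted : State R
      multiplying   = st finMul (r ∸ 1) l 0 W p Â B̂ X
      interpolating = st itftP (r ∸ 1) l 0 W p Â B̂ values
      halted        = st done (r ∸ 1) l 0 W p Â B̂ (blit R values 0 r (itft r values))

      bounded : ∀ {k} → k ≤ m + n → r ∸ 1 ≤ m + n × l ≤ m + n × k ≤ m + n
      bounded k≤ = ≤-trans (m∸n≤m r 1) r≤m+n , proj₁ (proj₂ (trace-end trace)) , k≤

      load-ω : Trace (st finW (r ∸ 1) l i w p a b X) 1 (evaluatingA 0) (K ⊔ ⌈log₂ r ⌉ + 1)
      load-ω = trace-step _ _ refl (trace-end trace) (bounded (m≤m+n m n))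

      horner-A : Trace (evaluatingA 0) m (evaluatingA m) m
      horner-A = trace-loop evaluatingA m
        (λ j j<m → horner-step-A _ l _ _ W p _ b X (m∸n≡suc[m∸suc[n]] m j j<m)) (λ _ _ → refl)
        (λ j _ → bounded (≤-trans (m∸n≤m m j) (m≤m+n m n)))

      horner-A-exit : Trace (evaluatingA m) 1 (evaluatingB 0) 1
      horner-A-exit = trace-step _ _ (horner-exit-A _ l _ W p Â b X (n∸n≡0 m))
        (bounded (≤-trans (m∸n≤m m m) (m≤m+n m n))) (bounded (m≤n+m n m))

      horner-B : Trace (evaluatingB 0) n (evaluatingB n) n
      horner-B = trace-loop evaluatingB n
        (λ j j<n → horner-step-B _ l _ _ W p Â _ X (m∸n≡suc[m∸suc[n]] n j j<n)) (λ _ _ → refl)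
        (λ j _ → bounded (≤-trans (m∸n≤m n j) (m≤n+m n m)))

      horner-B-exit : Trace (evaluatingB n) 1 multiplying 1
      horner-B-exit = trace-step _ _ (horner-exit-B _ l _ W p Â B̂ X (n∸n≡0 n))
        (bounded (≤-trans (m∸n≤m n n) (m≤n+m n m))) (bounded z≤n)

      multiply : Trace multiplying 1 interpolating 1
      multiply = trace-step _ _ (if-T (<⇒<ᵇ (∸-monoʳ-< {o = 0} (s≤s z≤n) 1≤r))) (bounded z≤n) (bounded z≤n)

      interpolate : Trace interpolating 1 halted (r * (⌈log₂ r ⌉ + 1))
      interpolate = trace-step _ _ refl (bounded z≤n) (bounded z≤n)

      values-Ĉ : ∀ t → t < r → values t ≈ Ĉ t
      values-Ĉ t t<r with m≤n⇒m<n∨m≡n (∸-monoˡ-≤ 1 t<r)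
      ... | inj₁ t<r∸1 = trans (reflexive (upd-other R X (r ∸ 1) _ t (<⇒≢ t<r∸1))) (prefix t t<r∸1)
      ... | inj₂ refl  = trans (reflexive (upd-same R X (r ∸ 1) _))
                               (*-cong (horner-complete R A′ m W) (horner-complete R B′ n W))

      result : ∀ j → j < r → State.X halted j ≈ prodCoeff R A B j
      result j j<r = trans (reflexive (blit-inside R values 0 r (itft r values) j j<r))
        (itft-spec r (prodCoeff R A B) values 1≤r (λ t t<r → trans (values-Ĉ t t<r) (sym (evalPoly-product t))) j j<r)

      completion : Completes s (budget + finalCost)
      completion = completes _ halted
        (trace ++ (load-ω ++ horner-A ++ horner-A-exit ++ horner-B ++ horner-B-exit ++ multiply ++ interpolate))
        refl result

    initial-invariant : ∀ X₀ → LoopInvariant 0 0 0 X₀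
    initial-invariant X₀ = record
      { q<r = 1≤r ; aligned = λ e _ → (2 ^ e) ∣0 ; l≤m+n = z≤n ; i≤m+n = z≤n ; prefix = λ _ () }

    completes-from-init : ∀ X₀ → Completes (init X₀) (loopCost P M r + finalCost)
    completes-from-init X₀ = Finish.completion (loop r 0 0 0 0# 0# 0# 0# X₀ ≤-refl (initial-invariant X₀))

    cst : ℕ
    cst = 3 * K + 30

    total-cost-bound : loopCost P M r + finalCost ≤ cst * (m + n) * (Λ + 1)
    total-cost-bound = total-cost≤ m n K Λ _ _ r _ _
      (≤-trans (⌊log₂⌋-mono-≤ r≤m+n) (⌊log₂n⌋≤⌈log₂n⌉ (m + n) 1≤m+n))
      (≤-trans (m∸n≤m r 1) r≤m+n) r≤m+n (⌈log₂⌉-mono-≤ r≤m+n)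
      (≤-trans (m⊔n≤m+n K _) (+-monoʳ-≤ K (⌈log₂⌉-mono-≤ r≤m+n)))
      (⌈log₂n⌉≤n (m + n)) 1≤m+n

    m+n≤cst*[m+n] : m + n ≤ cst * (m + n)
    m+n≤cst*[m+n] = m≤n*m (m + n) cst {{>-nonZero (≤-trans (s≤s z≤n) (m≤n+m 30 (3 * K)))}}

    runs-correctly : ∀ X₀ → ∃ λ t →
        (State.pc (run t X₀) ≡ done)
      × (totalCost t X₀ ≤ cst * (m + n) * (Λ + 1))
      × (∀ s → s < r → State.X (run t X₀) s ≈ prodCoeff R A B s)
      × (∀ u → u ≤ t → (State.q (run u X₀) ≤ cst * (m + n)) × (State.l (run u X₀) ≤ cst * (m + n))
                                                             × (State.i (run u X₀) ≤ cst * (m + n)))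
    runs-correctly X₀ with completes-from-init X₀
    ... | completes t final (reach , cost≤ , bounded) halted result =
        t
      , ≡.trans (≡.cong State.pc run≡final) halted
      , ≡.subst (_≤ _) (≡.sym (totalCost≡costOf t X₀)) (≤-trans cost≤ total-cost-bound)
      , (λ s s<r → ≡.subst (λ state → State.X state s ≈ prodCoeff R A B s) (≡.sym run≡final) (result s s<r))
      , λ u u≤t → widen {run u X₀} (≡.subst Bounded (≡.sym (run≡iter u X₀)) (bounded u u≤t))
      where
      run≡final : run t X₀ ≡ final
      run≡final = ≡.trans (run≡iter t X₀) reach
      widen : ∀ {state} → Bounded state → (State.q state ≤ cst * (m + n)) × (State.l state ≤ cst * (m + n))
                                         × (State.i state ≤ cst * (m + n))
      widen (q≤ , l≤ , i≤) = ≤-trans q≤ m+n≤cst*[m+n] , ≤-trans l≤ m+n≤cst*[m+n] , ≤-trans i≤ m+n≤cst*[m+n]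

proposition3 : ∀ {c ℓ : Level} (R : CommutativeRing c ℓ) →
    TwoNonZeroDivisor R →
    (ω : ℕ → CommutativeRing.Carrier R) (K : ℕ) →
    (∀ k → K ≤ k → PrimitiveRoot2^ R k (ω k)) →
    (∀ k → K ≤ k → CommutativeRing._≈_ R (CommutativeRing._*_ R (ω (suc k)) (ω (suc k))) (ω k)) →
    (fft itft : ℕ → (ℕ → CommutativeRing.Carrier R) → ℕ → CommutativeRing.Carrier R) →
    FFTSpec R ω K fft →
    ITFTSpec R ω K itft →
    ∃ λ (cst : ℕ) →
      ∀ (m n : ℕ) → 1 ≤ m → 1 ≤ n →
      (A : Fin m → CommutativeRing.Carrier R) (B : Fin n → CommutativeRing.Carrier R)
      (X₀ : ℕ → CommutativeRing.Carrier R) →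
      let open Machine R ω K fft itft A B in
      ∃ λ (t : ℕ) →
        (State.pc (run t X₀) ≡ done)
        × (totalCost t X₀ ≤ cst * (m + n) * ((⌈log₂ (m + n) ⌉) + 1))
        × (∀ s → s < n + m ∸ 1 →
             CommutativeRing._≈_ R (State.X (run t X₀) s) (prodCoeff R A B s))
        × (∀ u → u ≤ t →
             (State.q (run u X₀) ≤ cst * (m + n))
             × (State.l (run u X₀) ≤ cst * (m + n))
             × (State.i (run u X₀) ≤ cst * (m + n)))
-- That 2 is not a zero-divisor is needed only to implement the ITFT, which enters here through its specification.
proposition3 R _ ω K ω-primitive ω-compatible fft itft fft-spec itft-spec =
  3 * K + 30 , λ m n 1≤m 1≤n A B → Product.runs-correctly 1≤m 1≤n A B
  where open Correctness R ω K ω-primitive ω-compatible fft itft fft-spec itft-spec
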